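{- (1) There exists an LS$(1,2;2,(3,\{3,5\}),v)$ for $v=14$ and $v=26$. (2) For every odd positive integer $w$ there exists an LS$(1,3;2,(3,\{3\},\{3\},\{w+2\}),3w+2)$.
   Context: An S$(\lambda;2,K,v)$ is a pair $(X,\mathcal{B})$, $|X|=v$, $\mathcal{B}$ a multiset of subsets (blocks) of $X$ with sizes in $K$, each 2-subset of $X$ in exactly $\lambda$ blocks. An S$(3,K,v)$ is a pair $(X,\mathcal{B})$ with $\mathcal{B}$ a set of subsets of sizes in $K$, each 3-subset in exactly one block. An LS$(1,\lambda;2,(3,K),v)$ is a collection $(X,\mathcal{B}_r)_{r\in R}$ of S$(\lambda;2,K,v)$ on a common $X$ such that $(X,\bigcup_r\mathcal{B}_r)$ (ordinary union, not multiset union) is an S$(3,K,v)$ and each block $B$ of that union occurs exactly $|B|-2$ times in the multiset $\{B: B\in\mathcal{B}_r, r\in R\}$. An S$(\lambda;2,(K_0,K_1,K_2),v)$ is a quadruple $(S,\infty_1,\infty_2,\mathcal{B})$ with $|S|=v-2$, $\infty_1\ne\infty_2$, $\infty_1,\infty_2\notin S$, such that $(S\cup\{\infty_1,\infty_2\},\mathcal{B})$ is an S$(\lambda;2,K_0\cup K_1\cup K_2,v)$ and $|B|\in K_i$ for each block $B$ with $|B\cap\{\infty_1,\infty_2\}|=i$. An LS$(1,\lambda;2,(3,K_0,K_1,K_2),v)$ is a collection $(S,\infty_1,\infty_2,\mathcal{B}_r)_{r\in R}$ of such designs such that $(S\cup\{\infty_1,\infty_2\},\mathcal{B}_r)_{r\in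 R}$ is an LS$(1,\lambda;2,(3,K_0\cup K_1\cup K_2),v)$. -}

module Defs where

open import Data.Nat using (ℕ; zero; suc; _+_; _*_; _∸_)
open import Data.Bool using (Bool; true; false; _∧_; if_then_else_)
open import Data.Fin using (Fin)
open import Data.Fin.Subset using (Subset; _∈_; ∣_∣)
open import Data.Vec using (lookup)
open import Data.Vec.Properties using (≡-dec)
import Data.Bool.Properties as BoolP
open import Data.List using (List; []; _∷_; concat)
open import Data.List.Relation.Unary.All using (All)
import Data.List.Membership.Propositional as LMem
open import Data.Product using (Σ; ∃; ∃-syntax; _×_; _,_)
open import Data.Sum using (_⊎_)
open import Relation.Nullary using (¬_; does)
open import Relation.Binary.PropositionalEquality using (_≡_; _≢_)

Block : ℕ → Set
Block v = Subset v

SizeSet : Set₁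
SizeSet = ℕ → Set

count : {A : Set} → (A → Bool) → List A → ℕ
count p []       = 0
count p (a ∷ as) = (if p a then 1 else 0) + count p as

_≟B_ : {v : ℕ} → (B B′ : Block v) → Relation.Nullary.Dec (B ≡ B′)
_≟B_ = ≡-dec BoolP._≟_

mult : {v : ℕ} → Block v → List (Block v) → ℕ
mult B Bs = count (λ B′ → does (B′ ≟B B)) Bs

IsS2 : (lam : ℕ) (K : SizeSet) (v : ℕ) → List (Block v) → Set
IsS2 lam K v Bs =
  All (λ B → K ∣ B ∣) Bs ×
  ((x y : Fin v) → x ≢ y → count (λ B → lookup B x ∧ lookup B y) Bs ≡ lam)

IsS3 : (K : SizeSet) (v : ℕ) → (Block v → Set) → Set
IsS3 K v U =
  ((B : Block v) → U B → K ∣ B ∣) ×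
  ((x y z : Fin v) → x ≢ y → x ≢ z → y ≢ z →
     (∃[ B ] (U B × x ∈ B × y ∈ B × z ∈ B)) ×
     ((B B′ : Block v) → U B → x ∈ B → y ∈ B → z ∈ B →
                         U B′ → x ∈ B′ → y ∈ B′ → z ∈ B′ → B ≡ B′))

-- LS(1,λ;2,(3,K),v): a finite family (B_r)_{r ∈ R} (R = positions of the list)
-- of S(λ;2,K,v) on Fin v, whose ordinary union is an S(3,K,v) and where each
-- block B of the union occurs exactly |B|-2 times in the multiset union.
IsLS : (lam : ℕ) (K : SizeSet) (v : ℕ) → List (List (Block v)) → Set
IsLS lam K v Ds =
  All (IsS2 lam K v) Ds ×
  IsS3 K v (λ B → B LMem.∈ concat Ds) ×
  ((B : Block v) → B LMem.∈ concat Ds → mult B (concat Ds) ≡ ∣ B ∣ ∸ 2)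

infCount : {v : ℕ} → Fin v → Fin v → Block v → ℕ
infCount i₁ i₂ B = (if lookup B i₁ then 1 else 0) + (if lookup B i₂ then 1 else 0)

selK : SizeSet → SizeSet → SizeSet → ℕ → SizeSet
selK K₀ K₁ K₂ 0 = K₀
selK K₀ K₁ K₂ 1 = K₁
selK K₀ K₁ K₂ _ = K₂

_∪K_ : SizeSet → SizeSet → SizeSet
(K ∪K K′) n = K n ⊎ K′ n

-- LS(1,λ;2,(3,K₀,K₁,K₂),v) with distinguished points ∞₁ ≠ ∞₂ of Fin v
-- (S = Fin v ∖ {∞₁,∞₂}, so |S| = v - 2).
IsLS₃ : (lam : ℕ) (K₀ K₁ K₂ : SizeSet) (v : ℕ) (i₁ i₂ : Fin v) →
        List (List (Block v)) → Set
IsLS₃ lam K₀ K₁ K₂ v i₁ i₂ Ds =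
  i₁ ≢ i₂ ×
  IsLS lam (K₀ ∪K (K₁ ∪K K₂)) v Ds ×
  All (All (λ B → selK K₀ K₁ K₂ (infCount i₁ i₂ B) ∣ B ∣)) Ds

K35 : SizeSet
K35 n = n ≡ 3 ⊎ n ≡ 5

Odd : ℕ → Set
Odd w = ∃[ k ] w ≡ suc (2 * k)

-- (1) For v = 14 and v = 26 the designs are developed from explicit base designs by rotating
-- all points but two, and are verified by a boolean check that is proved sound.
-- (2) For odd w take the points {∞₁, ∞₂} ∪ ℤ₃ × ℤ_w. For every r ∈ ℤ_w, design r consists of the
-- three blocks {∞₁, ∞₂} ∪ {i} × ℤ_w and the triples {∞₁, (i, a), (i + 1, 2a + r)},
-- {∞₂, (i, a), (i − 1, 2a + r)}, {(0, a), (1, b), (2, r − a − b)} and {(i, y), (i, y′), (i ± 1, y + y′ + r)}.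
-- Doubling is invertible in ℤ_w, so every pair lies in exactly three blocks of each design, and
-- a triple of points outside every big block determines r through one linear equation, so it
-- lies in a single triple of the union.

module Submission where

open import Defs
open import Data.Nat using (ℕ; _+_; _*_)
open import Data.Fin using (Fin)
open import Data.List using (List)
open import Data.Product using (Σ; ∃; ∃-syntax; _×_; _,_)
open import Relation.Binary.PropositionalEquality using (_≡_)

module Counting where

  open import Defs using (count)
  open import Data.Nat using (ℕ; zero; suc; _+_; _≤_; z≤n; s≤s)
  open import Data.Nat.Properties using (+-0-commutativeMonoid; +-assoc; +-identityʳ; m≤n+m; ≤-trans; <-irrefl; suc-injective)
  open import Data.Bool using (Bool; true; false; T; _∧_; _∨_; not; if_then_else_)
  open import Data.Unit using (tt)
  open import Data.Fin using (Fin; zero; suc; _<_; _<?_; _↑ˡ_; _↑ʳ_; combine)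
  import Data.Nat as ℕ
  open import Data.Fin.Properties using (_≟_; <-cmp; <⇒≢)
  open import Relation.Binary.Definitions using (tri<; tri≈; tri>)
  open import Data.List using (List; []; _∷_; _++_; concat; tabulate; map)
  open import Data.List.Membership.Propositional using (_∈_)
  open import Data.List.Relation.Unary.Any using (here; there)
  open import Data.Product using (∃-syntax; _×_; _,_; proj₁; proj₂)
  open import Data.Sum using (_⊎_; inj₁; inj₂)
  open import Data.Empty using (⊥; ⊥-elim)
  open import Function using (_⇔_; mk⇔; _∘_)
  import Data.Fin.Properties as Fin
  open import Relation.Nullary using (¬_; Dec; yes; no; does; _×-dec_; _⊎-dec_)
  open import Relation.Nullary.Decidable using (dec-true; dec-false; does-⇔)
  open import Relation.Unary using (Pred; Decidable)
  open import Relation.Binary.PropositionalEquality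

  open import Algebra.Properties.CommutativeMonoid.Sum +-0-commutativeMonoid public
    using (sum; sum-cong-≗; ∑-distrib-+; sum-replicate-zero)

  ⟦_⟧ : Bool → ℕ
  ⟦ b ⟧ = if b then 1 else 0

  ⟦∨⟧ : ∀ a b → (a ∧ b) ≡ false → ⟦ a ∨ b ⟧ ≡ ⟦ a ⟧ + ⟦ b ⟧
  ⟦∨⟧ true  false _ = refl
  ⟦∨⟧ false b     _ = refl

  ∑-zero : ∀ {n} {f : Fin n → ℕ} → (∀ i → f i ≡ 0) → sum f ≡ 0
  ∑-zero {n} f≡0 = trans (sum-cong-≗ f≡0) (sum-replicate-zero n)

  ∑-support : ∀ {n} {f : Fin n → ℕ} i₀ → (∀ i → i ≢ i₀ → f i ≡ 0) → sum f ≡ f i₀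
  ∑-support {suc n} {f} zero off =
    trans (cong (f zero +_) (∑-zero λ i → off (suc i) λ ())) (+-identityʳ (f zero))
  ∑-support {suc n} {f} (suc i₀) off =
    cong₂ _+_ (off zero λ ()) (∑-support i₀ λ i i≢i₀ → off (suc i) (i≢i₀ ∘ Fin.suc-injective))

  ∑-const-1 : ∀ n → sum {n} (λ _ → 1) ≡ n
  ∑-const-1 zero    = refl
  ∑-const-1 (suc n) = cong suc (∑-const-1 n)

  ∑-splitAt : ∀ m {n} (f : Fin (m ℕ.+ n) → ℕ) → sum f ≡ sum (λ i → f (i ↑ˡ n)) + sum (λ j → f (m ↑ʳ j))
  ∑-splitAt zero    f = refl
  ∑-splitAt (suc m) {n} f =
    trans (cong (f zero +_) (∑-splitAt m (f ∘ suc)))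
          (sym (+-assoc (f zero) (sum λ i → f (suc i ↑ˡ n)) (sum λ j → f (suc m ↑ʳ j))))

  ∑-combine : ∀ m {n} (f : Fin (m ℕ.* n) → ℕ) → sum f ≡ sum λ (i : Fin m) → sum λ (j : Fin n) → f (combine i j)
  ∑-combine zero    f = refl
  ∑-combine (suc m) {n} f =
    trans (∑-splitAt n {m ℕ.* n} f) (cong₂ _+_ refl (∑-combine m {n} λ y → f (n ↑ʳ y)))

  witness : ∀ {a} {A : Set a} (a? : Dec A) → T (does a?) → A
  witness (yes a) _ = a

  witnessed : ∀ {a} {A : Set a} (a? : Dec A) → A → T (does a?)
  witnessed (yes _) _ = tt
  witnessed (no ¬a) a = ¬a a

  #_ : ∀ {n p} {P : Pred (Fin n) p} → Decidable P → ℕ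
  # P? = sum λ a → ⟦ does (P? a) ⟧

  module _ {n p} {P : Pred (Fin n) p} where

    #-none : (P? : Decidable P) → (∀ a → ¬ P a) → # P? ≡ 0
    #-none P? ¬P = ∑-zero λ a → cong ⟦_⟧ (dec-false (P? a) (¬P a))

    #-at : (P? : Decidable P) (a₀ : Fin n) → (∀ a → P a → a ≡ a₀) → # P? ≡ ⟦ does (P? a₀) ⟧
    #-at P? a₀ only = ∑-support a₀ λ a a≢a₀ → cong ⟦_⟧ (dec-false (P? a) (a≢a₀ ∘ only a))

    #-unique : (P? : Decidable P) (a₀ : Fin n) → P a₀ → (∀ a → P a → a ≡ a₀) → # P? ≡ 1
    #-unique P? a₀ pa₀ only = trans (#-at P? a₀ only) (cong ⟦_⟧ (dec-true (P? a₀) pa₀))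

  module _ {n p q} {P : Pred (Fin n) p} {Q : Pred (Fin n) q} where

    #-cong : (P? : Decidable P) (Q? : Decidable Q) → (∀ a → P a ⇔ Q a) → # P? ≡ # Q?
    #-cong P? Q? P⇔Q = sum-cong-≗ λ a → cong ⟦_⟧ (does-⇔ (P⇔Q a) (P? a) (Q? a))

    #-⊎ : (P? : Decidable P) (Q? : Decidable Q) → (∀ a → P a → ¬ Q a) →
          # (λ a → P? a ⊎-dec Q? a) ≡ # P? + # Q?
    #-⊎ P? Q? disjoint =
      trans (sum-cong-≗ λ a → ⟦∨⟧ (does (P? a)) (does (Q? a)) (both-false a))
            (∑-distrib-+ (λ a → ⟦ does (P? a) ⟧) (λ a → ⟦ does (Q? a) ⟧))
      where
        both-false : ∀ a → (does (P? a) ∧ does (Q? a)) ≡ false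
        both-false a = dec-false (P? a ×-dec Q? a) λ (p , q) → disjoint a p q

  ∑#-none : ∀ {m n p} {P : Fin m → Pred (Fin n) p} (P? : ∀ i → Decidable (P i)) →
            (∀ i a → ¬ P i a) → sum (λ i → # P? i) ≡ 0
  ∑#-none P? ¬P = ∑-zero λ i → #-none (P? i) (¬P i)

  ∑#-at : ∀ {m n p} {P : Fin m → Pred (Fin n) p} (P? : ∀ i → Decidable (P i)) i₀ a₀ →
          (∀ i a → P i a → i ≡ i₀ × a ≡ a₀) → sum (λ i → # P? i) ≡ ⟦ does (P? i₀ a₀) ⟧
  ∑#-at P? i₀ a₀ only =
    trans (∑-support i₀ λ i i≢i₀ → #-none (P? i) λ a → i≢i₀ ∘ proj₁ ∘ only i a)
          (#-at (P? i₀) a₀ λ a → proj₂ ∘ only i₀ a)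

  ∑#-unique : ∀ {m n p} {P : Fin m → Pred (Fin n) p} (P? : ∀ i → Decidable (P i)) i₀ a₀ →
              P i₀ a₀ → (∀ i a → P i a → i ≡ i₀ × a ≡ a₀) → sum (λ i → # P? i) ≡ 1
  ∑#-unique P? i₀ a₀ p only = trans (∑#-at P? i₀ a₀ only) (cong ⟦_⟧ (dec-true (P? i₀ a₀) p))

  ∑#-solve : ∀ {m n p q} {P : Fin m → Pred (Fin n) p} {Q : Set q} (P? : ∀ i → Decidable (P i)) i₀ a₀ →
             (∀ i a → P i a → i ≡ i₀ × a ≡ a₀) → P i₀ a₀ ⇔ Q → (Q? : Dec Q) →
             sum (λ i → # P? i) ≡ ⟦ does Q? ⟧
  ∑#-solve P? i₀ a₀ only P⇔Q Q? =
    trans (∑#-at P? i₀ a₀ only) (cong ⟦_⟧ (does-⇔ P⇔Q (P? i₀ a₀) Q?))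

  module _ {m n p q} {P : Fin m → Pred (Fin n) p} {Q : Fin m → Pred (Fin n) q} where

    ∑#-cong : (P? : ∀ i → Decidable (P i)) (Q? : ∀ i → Decidable (Q i)) → (∀ i a → P i a ⇔ Q i a) →
              sum (λ i → # P? i) ≡ sum (λ i → # Q? i)
    ∑#-cong P? Q? P⇔Q = sum-cong-≗ λ i → #-cong (P? i) (Q? i) (P⇔Q i)

    ∑#-⊎ : (P? : ∀ i → Decidable (P i)) (Q? : ∀ i → Decidable (Q i)) → (∀ i a → P i a → ¬ Q i a) →
           sum (λ i → # (λ a → P? i a ⊎-dec Q? i a)) ≡ sum (λ i → # P? i) + sum (λ i → # Q? i)
    ∑#-⊎ P? Q? disjoint = trans (sum-cong-≗ λ i → #-⊎ (P? i) (Q? i) (disjoint i))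
                                (∑-distrib-+ (λ i → # P? i) (λ i → # Q? i))

  ∑#-×-const : ∀ {m n p q} {P : Fin m → Pred (Fin n) p} {Q : Set q} (P? : ∀ i → Decidable (P i)) (Q? : Dec Q) →
               sum (λ i → # P? i) ≡ 1 → sum (λ i → # λ a → P? i a ×-dec Q?) ≡ ⟦ does Q? ⟧
  ∑#-×-const P? (yes q) once = trans (∑#-cong (λ i a → P? i a ×-dec yes q) P? λ _ _ → mk⇔ proj₁ (_, q)) once
  ∑#-×-const P? (no ¬q) once = ∑#-none (λ i a → P? i a ×-dec no ¬q) λ i a (_ , q) → ¬q q

  module _ {A : Set} (p : A → Bool) where

    count-++ : ∀ xs ys → count p (xs ++ ys) ≡ count p xs + count p ys
    count-++ []       ys = refl
    count-++ (x ∷ xs) ys = trans (cong (⟦ p x ⟧ +_) (count-++ xs ys)) (sym (+-assoc ⟦ p x ⟧ _ _))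

    count-tabulate : ∀ {n} (f : Fin n → A) → count p (tabulate f) ≡ sum (λ i → ⟦ p (f i) ⟧)
    count-tabulate {zero}  f = refl
    count-tabulate {suc n} f = cong (⟦ p (f zero) ⟧ +_) (count-tabulate (f ∘ suc))

    count-concat-tabulate : ∀ {n} (f : Fin n → List A) →
                            count p (concat (tabulate f)) ≡ sum (λ i → count p (f i))
    count-concat-tabulate {zero}  f = refl
    count-concat-tabulate {suc n} f =
      trans (count-++ (f zero) _) (cong (count p (f zero) +_) (count-concat-tabulate (f ∘ suc)))

    count-if : ∀ b x → count p (if b then x ∷ [] else []) ≡ ⟦ b ∧ p x ⟧
    count-if true  x = +-identityʳ ⟦ p x ⟧
    count-if false x = refl

    ∈⇒1≤count : ∀ {x xs} → x ∈ xs → p x ≡ true → 1 ≤ count p xs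
    ∈⇒1≤count {xs = _ ∷ _}  (here refl) px rewrite px = s≤s z≤n
    ∈⇒1≤count {xs = y ∷ xs} (there x∈) px = ≤-trans (∈⇒1≤count x∈ px) (m≤n+m (count p xs) ⟦ p y ⟧)

    1≤count⇒∈ : ∀ xs → 1 ≤ count p xs → ∃[ x ] x ∈ xs × p x ≡ true
    1≤count⇒∈ (x ∷ xs) pos with p x in px
    ... | true  = x , here refl , px
    ... | false = let y , y∈ , py = 1≤count⇒∈ xs pos in y , there y∈ , py

    count≡1⇒unique : ∀ {xs x y} → count p xs ≡ 1 → x ∈ xs → p x ≡ true → y ∈ xs → p y ≡ true → x ≡ y
    count≡1⇒unique {xs = z ∷ xs} c (here refl) _ (here refl) _ = refl
    count≡1⇒unique {xs = z ∷ xs} c (here refl) px (there y∈) py rewrite px =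
      ⊥-elim (<-irrefl (sym (suc-injective c)) (∈⇒1≤count y∈ py))
    count≡1⇒unique {xs = z ∷ xs} c (there x∈) px (here refl) py rewrite py =
      ⊥-elim (<-irrefl (sym (suc-injective c)) (∈⇒1≤count x∈ px))
    count≡1⇒unique {xs = z ∷ xs} c (there x∈) px (there y∈) py with p z
    ... | true  = ⊥-elim (<-irrefl (sym (suc-injective c)) (∈⇒1≤count x∈ px))
    ... | false = count≡1⇒unique c x∈ px y∈ py

  count-map : ∀ {A B : Set} (p : B → Bool) (f : A → B) xs → count p (map f xs) ≡ count (p ∘ f) xs
  count-map p f []       = refl
  count-map p f (x ∷ xs) = cong (⟦ p (f x) ⟧ +_) (count-map p f xs)

  count-cong-∈ : ∀ {A : Set} {p q : A → Bool} xs → (∀ {x} → x ∈ xs → p x ≡ q x) → count p xs ≡ count q xs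
  count-cong-∈ []       p≡q = refl
  count-cong-∈ (x ∷ xs) p≡q = cong₂ _+_ (cong ⟦_⟧ (p≡q (here refl))) (count-cong-∈ xs (p≡q ∘ there))

  module _ {n : ℕ} where

    UnorderedPair : Fin n → Fin n → Fin n → Fin n → Set
    UnorderedPair c e y y′ = (c ≡ y × e ≡ y′) ⊎ (c ≡ y′ × e ≡ y)

    unorderedPair? : ∀ c e y y′ → Dec (UnorderedPair c e y y′)
    unorderedPair? c e y y′ = (c ≟ y ×-dec e ≟ y′) ⊎-dec (c ≟ y′ ×-dec e ≟ y)

    #-unordered-pair : ∀ c e → sum (λ y → # λ y′ → y <? y′ ×-dec unorderedPair? c e y y′) ≡ ⟦ not (does (c ≟ e)) ⟧
    #-unordered-pair c e = begin
      sum (λ y → # λ y′ → y <? y′ ×-dec unorderedPair? c e y y′)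
        ≡⟨ ∑#-cong (λ y y′ → y <? y′ ×-dec unorderedPair? c e y y′)
                   (λ y y′ → ordered? c e y y′ ⊎-dec ordered? e c y y′) (λ y y′ → mk⇔ split join) ⟩
      sum (λ y → # λ y′ → ordered? c e y y′ ⊎-dec ordered? e c y y′)
        ≡⟨ ∑#-⊎ (ordered? c e) (ordered? e c) (λ { y y′ (c<e , refl , refl) (_ , e≡c , _) → Fin.<-irrefl (sym e≡c) c<e }) ⟩
      sum (λ y → # ordered? c e y) + sum (λ y → # ordered? e c y)
        ≡⟨ cong₂ _+_ (at c e) (at e c) ⟩
      ⟦ does (c <? e) ⟧ + ⟦ does (e <? c) ⟧
        ≡⟨ trichotomy ⟩
      ⟦ not (does (c ≟ e)) ⟧ ∎
      where
        open ≡-Reasoning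
        ordered? : ∀ c e y y′ → Dec (y < y′ × c ≡ y × e ≡ y′)
        ordered? c e y y′ = y <? y′ ×-dec (c ≟ y ×-dec e ≟ y′)
        split : ∀ {c e y y′} → y < y′ × UnorderedPair c e y y′ → (y < y′ × c ≡ y × e ≡ y′) ⊎ (y < y′ × e ≡ y × c ≡ y′)
        split (y<y′ , inj₁ (c≡y , e≡y′)) = inj₁ (y<y′ , c≡y , e≡y′)
        split (y<y′ , inj₂ (c≡y′ , e≡y)) = inj₂ (y<y′ , e≡y , c≡y′)
        join : ∀ {c e y y′} → (y < y′ × c ≡ y × e ≡ y′) ⊎ (y < y′ × e ≡ y × c ≡ y′) → y < y′ × UnorderedPair c e y y′
        join (inj₁ (y<y′ , c≡y , e≡y′)) = y<y′ , inj₁ (c≡y , e≡y′)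
        join (inj₂ (y<y′ , e≡y , c≡y′)) = y<y′ , inj₂ (c≡y′ , e≡y)
        at : ∀ c e → sum (λ y → # ordered? c e y) ≡ ⟦ does (c <? e) ⟧
        at c e = ∑#-solve (ordered? c e) c e (λ { y y′ (_ , refl , refl) → refl , refl })
                   (mk⇔ proj₁ (_, refl , refl)) (c <? e)
        trichotomy : ⟦ does (c <? e) ⟧ + ⟦ does (e <? c) ⟧ ≡ ⟦ not (does (c ≟ e)) ⟧
        trichotomy with <-cmp c e
        ... | tri< c<e _ e≮c rewrite dec-true (c <? e) c<e | dec-false (e <? c) e≮c
                                   | dec-false (c ≟ e) (<⇒≢ c<e) = refl
        ... | tri≈ c≮e refl _ rewrite dec-false (c <? c) c≮e | dec-true (c ≟ c) refl = refl
        ... | tri> c≮e _ e<c rewrite dec-false (c <? e) c≮e | dec-true (e <? c) e<c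
                                   | dec-false (c ≟ e) (<⇒≢ e<c ∘ sym) = refl

  pigeonhole₂ : ∀ {A : Set} {x₁ x₂ x₃ u v : A} → x₁ ≡ u ⊎ x₁ ≡ v → x₂ ≡ u ⊎ x₂ ≡ v → x₃ ≡ u ⊎ x₃ ≡ v →
                x₁ ≢ x₂ → x₁ ≢ x₃ → x₂ ≢ x₃ → ⊥
  pigeonhole₂ (inj₁ a) (inj₁ b) _        x₁≢x₂ _     _     = x₁≢x₂ (trans a (sym b))
  pigeonhole₂ (inj₂ a) (inj₂ b) _        x₁≢x₂ _     _     = x₁≢x₂ (trans a (sym b))
  pigeonhole₂ (inj₁ a) (inj₂ b) (inj₁ c) _     x₁≢x₃ _     = x₁≢x₃ (trans a (sym c))
  pigeonhole₂ (inj₁ a) (inj₂ b) (inj₂ c) _     _     x₂≢x₃ = x₂≢x₃ (trans b (sym c))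
  pigeonhole₂ (inj₂ a) (inj₁ b) (inj₁ c) _     _     x₂≢x₃ = x₂≢x₃ (trans b (sym c))
  pigeonhole₂ (inj₂ a) (inj₁ b) (inj₂ c) _     x₁≢x₃ _     = x₁≢x₃ (trans a (sym c))

module TripleCovers where

  open import Defs
  open Counting
  open import Data.Nat using (_∸_)
  open import Data.Bool using (Bool; true; false; _∧_)
  open import Data.Bool.Properties using (∧-commutativeMonoid)
  open import Algebra.Bundles using (CommutativeMonoid)
  open import Algebra.Properties.CommutativeSemigroup (CommutativeMonoid.commutativeSemigroup ∧-commutativeMonoid)
    using (x∙yz≈y∙xz; x∙yz≈x∙zy)
  open import Data.Fin using (Fin; _<_)
  open import Data.Fin.Subset using (Subset; ∣_∣)
  import Data.Fin.Subset as Subset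
  open import Data.Vec using (lookup)
  open import Data.Vec.Properties using (lookup⇒[]=; []=⇒lookup)
  open import Data.List using (List)
  open import Data.List.Membership.Propositional using (_∈_)
  open import Data.Product using (∃-syntax; _×_; _,_)
  open import Relation.Nullary using (does; yes; no; contradiction)
  open import Relation.Binary.Definitions using (tri<; tri≈; tri>)
  open import Data.Fin.Properties using (<-cmp)
  open import Relation.Binary.PropositionalEquality

  Contains₃ : ∀ {v} → Fin v → Fin v → Fin v → Block v → Bool
  Contains₃ x y z B = lookup B x ∧ lookup B y ∧ lookup B z

  record TripleCover {v} (L : List (Block v)) (x y z : Fin v) : Set where
    field
      block   : Block v
      ∈L      : block ∈ L
      through : Contains₃ x y z block ≡ true
      unique  : ∀ {B} → B ∈ L → Contains₃ x y z B ≡ true → B ≡ block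
      count≡  : count (Contains₃ x y z) L ≡ ∣ block ∣ ∸ 2

  module _ {v} {L : List (Block v)} where

    private
      permuted : ∀ {x y z x′ y′ z′} → (∀ B → Contains₃ x y z B ≡ Contains₃ x′ y′ z′ B) →
                 TripleCover L x y z → TripleCover L x′ y′ z′
      permuted same c = record
        { block = block ; ∈L = ∈L ; through = trans (sym (same block)) through
        ; unique = λ {B} B∈ t → unique B∈ (trans (same B) t)
        ; count≡ = trans (count-cong-∈ L λ {B} _ → sym (same B)) count≡ }
        where open TripleCover c

    TripleCover-swap₁₂ : ∀ {x y z} → TripleCover L x y z → TripleCover L y x z
    TripleCover-swap₁₂ {x} {y} {z} = permuted λ B → x∙yz≈y∙xz (lookup B x) (lookup B y) (lookup B z)

    TripleCover-swap₂₃ : ∀ {x y z} → TripleCover L x y z → TripleCover L x z y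
    TripleCover-swap₂₃ {x} {y} {z} = permuted λ B → x∙yz≈x∙zy (lookup B x) (lookup B y) (lookup B z)

    module _ (sorted : ∀ {x y z} → x < y → y < z → TripleCover L x y z) where

      private
        first-two-sorted : ∀ {x y z} → x < y → x ≢ z → y ≢ z → TripleCover L x y z
        first-two-sorted {x} {y} {z} x<y x≢z y≢z with <-cmp y z | <-cmp x z
        ... | tri< y<z _ _ | _            = sorted x<y y<z
        ... | tri> _ _ z<y | tri< x<z _ _ = TripleCover-swap₂₃ (sorted x<z z<y)
        ... | tri> _ _ z<y | tri> _ _ z<x = TripleCover-swap₂₃ (TripleCover-swap₁₂ (sorted z<x x<y))
        ... | tri≈ _ y≡z _ | _            = contradiction y≡z y≢z
        ... | _            | tri≈ _ x≡z _ = contradiction x≡z x≢z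

      TripleCover-sorted : ∀ {x y z} → x ≢ y → x ≢ z → y ≢ z → TripleCover L x y z
      TripleCover-sorted {x} {y} {z} x≢y x≢z y≢z with <-cmp x y
      ... | tri< x<y _ _ = first-two-sorted x<y x≢z y≢z
      ... | tri> _ _ y<x = TripleCover-swap₁₂ (first-two-sorted y<x y≢z x≢z)
      ... | tri≈ _ x≡y _ = contradiction x≡y x≢y

  through⇒∈ : ∀ {v} {x y z : Fin v} B → Contains₃ x y z B ≡ true → x Subset.∈ B × y Subset.∈ B × z Subset.∈ B
  through⇒∈ {x = x} {y} {z} B t with lookup B x in bx | lookup B y in by | lookup B z in bz
  through⇒∈ {x = x} {y} {z} B refl | true | true | true = lookup⇒[]= x B bx , lookup⇒[]= y B by , lookup⇒[]= z B bz

  ∈⇒through : ∀ {v} {x y z : Fin v} {B} → x Subset.∈ B → y Subset.∈ B → z Subset.∈ B → Contains₃ x y z B ≡ true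
  ∈⇒through x∈ y∈ z∈ rewrite []=⇒lookup x∈ | []=⇒lookup y∈ | []=⇒lookup z∈ = refl

  module _ {v} {K : SizeSet} {L : List (Block v)}
           (sizes : ∀ {B} → B ∈ L → K ∣ B ∣)
           (three-points : ∀ {B} → B ∈ L →
              ∃[ x ] ∃[ y ] ∃[ z ] x ≢ y × x ≢ z × y ≢ z × Contains₃ x y z B ≡ true)
           (cover : ∀ {x y z} → x ≢ y → x ≢ z → y ≢ z → TripleCover L x y z) where

    covered-S3 : IsS3 K v (_∈ L)
    covered-S3 = (λ _ → sizes) , λ x y z x≢y x≢z y≢z →
      let open TripleCover (cover x≢y x≢z y≢z) in
      (block , ∈L , through⇒∈ block through) ,
      λ B B′ B∈ x∈ y∈ z∈ B′∈ x∈′ y∈′ z∈′ →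
        trans (unique B∈ (∈⇒through x∈ y∈ z∈)) (sym (unique B′∈ (∈⇒through x∈′ y∈′ z∈′)))

    covered-multiplicity : (B : Block v) → B ∈ L → mult B L ≡ ∣ B ∣ ∸ 2
    covered-multiplicity B B∈ with three-points B∈
    ... | x , y , z , x≢y , x≢z , y≢z , through-B =
      trans (count-cong-∈ L same) (trans count≡ (cong (λ C → ∣ C ∣ ∸ 2) (sym B≡block)))
      where
        open TripleCover (cover x≢y x≢z y≢z)
        B≡block : B ≡ block
        B≡block = unique B∈ through-B
        same : ∀ {B′} → B′ ∈ L → does (B′ ≟B B) ≡ Contains₃ x y z B′
        same {B′} B′∈ with B′ ≟B B | Contains₃ x y z B′ in t
        ... | yes refl | _     = sym (trans (sym t) through-B)
        ... | no  _    | false = refl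
        ... | no  B′≢B | true  = contradiction (trans (unique B′∈ t) (sym B≡block)) B′≢B

module Verification where

  open import Defs
  open Counting
  open TripleCovers
  open import Data.Nat using (ℕ; zero; suc; _+_; _∸_; _≡ᵇ_)
  open import Data.Nat.Properties using (_≟_; ≡ᵇ⇒≡)
  open import Data.Bool using (Bool; true; false; T; _∧_; _∨_; not; if_then_else_)
  open import Data.Bool.Properties using (∧-comm)
  open import Data.Fin using (Fin; zero; suc; _<_; _<?_)
  open import Data.Fin.Properties using (<⇒≢; <-trans; <-cmp)
  open import Data.Fin.Subset using (∣_∣)
  open import Data.Vec using (lookup)
  open import Data.List using (List; []; _∷_; concat; length; allFin)
  open import Data.List.Membership.Propositional using (_∈_)
  open import Data.List.Relation.Unary.Any using (here; there)
  open import Data.List.Relation.Unary.All using (All; []; _∷_)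
  import Data.List.Relation.Unary.All as All
  open import Data.Product using (_×_; _,_; proj₁; proj₂; ∃-syntax)
  open import Data.Unit using (tt)
  open import Function using (_∘_; Equivalence)
  open import Relation.Nullary using (Dec; does; contradiction; _⊎-dec_)
  open import Relation.Nullary.Decidable using (T?)
  open import Relation.Binary.Definitions using (tri<; tri≈; tri>)
  open import Relation.Binary.PropositionalEquality

  keep : ∀ {A : Set} → (A → Bool) → List A → List A
  keep p []       = []
  keep p (x ∷ xs) = if p x then x ∷ keep p xs else keep p xs

  module _ {A : Set} (p : A → Bool) where

    ∈-keep⁻ : ∀ {x} xs → x ∈ keep p xs → x ∈ xs × p x ≡ true
    ∈-keep⁻ (y ∷ xs) x∈ with p y in py
    ∈-keep⁻ (y ∷ xs) (here refl) | true = here refl , py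
    ∈-keep⁻ (y ∷ xs) (there x∈)  | true = let x∈xs , px = ∈-keep⁻ xs x∈ in there x∈xs , px
    ∈-keep⁻ (y ∷ xs) x∈          | false = let x∈xs , px = ∈-keep⁻ xs x∈ in there x∈xs , px

    ∈-keep⁺ : ∀ {x xs} → x ∈ xs → p x ≡ true → x ∈ keep p xs
    ∈-keep⁺ {xs = y ∷ xs} (here refl) px rewrite px = here refl
    ∈-keep⁺ {xs = y ∷ xs} (there x∈)  px with p y
    ... | true  = there (∈-keep⁺ x∈ px)
    ... | false = ∈-keep⁺ x∈ px

    count≡length-keep : ∀ xs → count p xs ≡ length (keep p xs)
    count≡length-keep []       = refl
    count≡length-keep (x ∷ xs) with p x
    ... | true  = cong suc (count≡length-keep xs)
    ... | false = count≡length-keep xs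

    count-∧-keep : ∀ (q : A → Bool) xs → count (λ a → p a ∧ q a) xs ≡ count q (keep p xs)
    count-∧-keep q []       = refl
    count-∧-keep q (x ∷ xs) with p x
    ... | true  = cong (⟦ q x ⟧ +_) (count-∧-keep q xs)
    ... | false = count-∧-keep q xs

  ∧⁻ : ∀ a {b} → T (a ∧ b) → T a × T b
  ∧⁻ true t = tt , t

  every : ∀ {n} → (Fin n → Bool) → Bool
  every {zero}  p = true
  every {suc n} p = p zero ∧ every (p ∘ suc)

  every-sound : ∀ {n} (p : Fin n → Bool) → T (every p) → ∀ i → T (p i)
  every-sound {suc n} p ok zero    = proj₁ (∧⁻ (p zero) ok)
  every-sound {suc n} p ok (suc i) = every-sound (p ∘ suc) (proj₂ (∧⁻ (p zero) ok)) i

  implies : ∀ {b c} → T (not b ∨ c) → T b → T c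
  implies {true} ok _ = ok

  K35? : ∀ m → Dec (K35 m)
  K35? m = m ≟ 3 ⊎-dec m ≟ 5

  module _ {v : ℕ} where

    blocks-through : Fin v → List (Block v) → List (Block v)
    blocks-through x = keep λ B → lookup B x

    check-S2 : List (Block v) → Bool
    check-S2 D = does (All.all? (K35? ∘ ∣_∣) D) ∧ every λ x → pairs-from x (blocks-through x D)
      where
        pairs-from : Fin v → List (Block v) → Bool
        pairs-from x Dx = every λ y → not (does (x <? y)) ∨ (count (λ B → lookup B y) Dx ≡ᵇ 2)

    check-S2-sound : ∀ D → T (check-S2 D) → IsS2 2 K35 v D
    check-S2-sound D ok with ∧⁻ (does (All.all? (K35? ∘ ∣_∣) D)) ok
    ... | sizes , pairs = witness (All.all? (K35? ∘ ∣_∣) D) sizes , λ x y x≢y → by-order x≢y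
      where
        sorted : ∀ {x y} → x < y → count (λ B → lookup B x ∧ lookup B y) D ≡ 2
        sorted {x} {y} x<y =
          trans (count-∧-keep (λ B → lookup B x) (λ B → lookup B y) D)
                (≡ᵇ⇒≡ _ 2 (implies (every-sound _ (every-sound _ pairs x) y) (witnessed (x <? y) x<y)))
        by-order : ∀ {x y} → x ≢ y → count (λ B → lookup B x ∧ lookup B y) D ≡ 2
        by-order {x} {y} x≢y with <-cmp x y
        ... | tri< x<y _ _ = sorted x<y
        ... | tri> _ _ y<x = trans (count-cong-∈ D λ {B} _ → ∧-comm (lookup B x) (lookup B y)) (sorted y<x)
        ... | tri≈ _ x≡y _ = contradiction x≡y x≢y

    single-block-repeated : List (Block v) → Bool
    single-block-repeated []       = false
    single-block-repeated (B ∷ Bs) = does (All.all? (_≟B B) Bs) ∧ (suc (length Bs) ≡ᵇ ∣ B ∣ ∸ 2)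

    covers-from₂ : Fin v → List (Block v) → Bool
    covers-from₂ y Lxy = every λ z → not (does (y <? z)) ∨ single-block-repeated (blocks-through z Lxy)

    covers-from : Fin v → List (Block v) → Bool
    covers-from x Lx = every λ y → not (does (x <? y)) ∨ covers-from₂ y (blocks-through y Lx)

    -- filtering the blocks one point at a time keeps every filter short
    check-covers : List (Block v) → Bool
    check-covers L = every λ x → covers-from x (blocks-through x L)

    repeated-block-cover : ∀ {L x y z} M → (∀ {B} → B ∈ M → B ∈ L × Contains₃ x y z B ≡ true) →
                           (∀ {B} → B ∈ L → Contains₃ x y z B ≡ true → B ∈ M) →
                           count (Contains₃ x y z) L ≡ length M → T (single-block-repeated M) → TripleCover L x y z
    repeated-block-cover (B ∷ Bs) sound complete counted ok = record
      { block   = B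
      ; ∈L      = proj₁ (sound (here refl))
      ; through = proj₂ (sound (here refl))
      ; unique  = λ B′∈ contains → copy (complete B′∈ contains)
      ; count≡  = trans counted (≡ᵇ⇒≡ _ _ (proj₂ (∧⁻ _ ok))) }
      where
        copies : All (_≡ B) Bs
        copies = witness (All.all? (_≟B B) Bs) (proj₁ (∧⁻ _ ok))
        copy : ∀ {B′} → B′ ∈ B ∷ Bs → B′ ≡ B
        copy (here refl) = refl
        copy (there B′∈) = All.lookup copies B′∈

    check-covers-sound : ∀ L → T (check-covers L) → ∀ {x y z} → x < y → y < z → TripleCover L x y z
    check-covers-sound L ok {x} {y} {z} x<y y<z = repeated-block-cover M sound complete counted repeated
      where
        Lx Lxy M : List (Block v)
        Lx = blocks-through x L
        Lxy = blocks-through y Lx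
        M = blocks-through z Lxy
        repeated : T (single-block-repeated M)
        repeated = implies (every-sound _ (implies (every-sound _ (every-sound _ ok x) y) (witnessed (x <? y) x<y)) z)
                           (witnessed (y <? z) y<z)
        sound : ∀ {B} → B ∈ M → B ∈ L × Contains₃ x y z B ≡ true
        sound {B} B∈ with ∈-keep⁻ (λ B → lookup B z) Lxy B∈
        ... | B∈Lxy , bz with ∈-keep⁻ (λ B → lookup B y) Lx B∈Lxy
        ... | B∈Lx , by with ∈-keep⁻ (λ B → lookup B x) L B∈Lx
        ... | B∈L , bx rewrite bx | by | bz = B∈L , refl
        complete : ∀ {B} → B ∈ L → Contains₃ x y z B ≡ true → B ∈ M
        complete {B} B∈ contains with lookup B x in bx | lookup B y in by | lookup B z in bz
        complete {B} B∈ refl | true | true | true =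
          ∈-keep⁺ (λ B → lookup B z) (∈-keep⁺ (λ B → lookup B y) (∈-keep⁺ (λ B → lookup B x) B∈ bx) by) bz
        counted : count (Contains₃ x y z) L ≡ length M
        counted = trans (count-∧-keep (λ B → lookup B x) (λ B → lookup B y ∧ lookup B z) L)
                 (trans (count-∧-keep (λ B → lookup B y) (λ B → lookup B z) Lx)
                        (count≡length-keep (λ B → lookup B z) Lxy))

    points : Block v → List (Fin v)
    points B = keep (lookup B) (allFin v)

    ordered-triple : List (Fin v) → Bool
    ordered-triple (x ∷ y ∷ z ∷ _) = does (x <? y) ∧ does (y <? z)
    ordered-triple _               = false

    corners : ∀ B → T (ordered-triple (points B)) →
              ∃[ x ] ∃[ y ] ∃[ z ] x ≢ y × x ≢ z × y ≢ z × Contains₃ x y z B ≡ true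
    corners B ok with points B in eq
    ... | x ∷ y ∷ z ∷ _ = x , y , z , <⇒≢ x<y , <⇒≢ (<-trans x<y y<z) , <⇒≢ y<z , contains
      where
        x<y : x < y
        x<y = witness (x <? y) (proj₁ (∧⁻ _ ok))
        y<z : y < z
        y<z = witness (y <? z) (proj₂ (∧⁻ _ ok))
        member : ∀ {a} → a ∈ points B → lookup B a ≡ true
        member a∈ = proj₂ (∈-keep⁻ (lookup B) (allFin v) a∈)
        contains : Contains₃ x y z B ≡ true
        contains rewrite member (subst (x ∈_) (sym eq) (here refl))
                       | member (subst (y ∈_) (sym eq) (there (here refl)))
                       | member (subst (z ∈_) (sym eq) (there (there (here refl)))) = refl

    check-LS : List (List (Block v)) → Bool
    check-LS Ds = does (All.all? (T? ∘ check-S2) Ds) ∧ check-covers (concat Ds) ∧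
                  does (All.all? (T? ∘ ordered-triple ∘ points) (concat Ds)) ∧
                  does (All.all? (K35? ∘ ∣_∣) (concat Ds))

    check-LS-sound : ∀ Ds → T (check-LS Ds) → IsLS 2 K35 v Ds
    check-LS-sound Ds ok with ∧⁻ (does (All.all? (T? ∘ check-S2) Ds)) ok
    ... | s2-ok , ok′ with ∧⁻ (check-covers (concat Ds)) ok′
    ... | covers-ok , ok″ with ∧⁻ (does (All.all? (T? ∘ ordered-triple ∘ points) (concat Ds))) ok″
    ... | corners-ok , sizes-ok =
      All.map (check-S2-sound _) (witness (All.all? (T? ∘ check-S2) Ds) s2-ok) ,
      covered-S3 {K = K35} sizes three-points covers ,
      covered-multiplicity {K = K35} sizes three-points covers
      where
        L : List (Block v)
        L = concat Ds
        sizes : ∀ {B} → B ∈ L → K35 ∣ B ∣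
        sizes = All.lookup (witness (All.all? (K35? ∘ ∣_∣) L) sizes-ok)
        three-points : ∀ {B} → B ∈ L → ∃[ x ] ∃[ y ] ∃[ z ] x ≢ y × x ≢ z × y ≢ z × Contains₃ x y z B ≡ true
        three-points {B} B∈ =
          corners B (All.lookup (witness (All.all? (T? ∘ ordered-triple ∘ points) L) corners-ok) B∈)
        covers : ∀ {x y z} → x ≢ y → x ≢ z → y ≢ z → TripleCover L x y z
        covers = TripleCover-sorted (check-covers-sound L covers-ok)

module Construction where

  open Counting
  open import Defs using (count)
  open import Data.Nat using (ℕ; _+_)
  open import Data.Nat.Properties using (+-identityʳ)
  open import Data.Bool using (Bool; true; false; _∧_; not; if_then_else_)
  open import Data.Fin using (Fin; _<_; _<?_; opposite)
  open import Data.Fin.Patterns using (0F; 1F; 2F)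
  open import Data.Fin.Properties using (_≟_; <⇒≢)
  open import Data.List using (List; []; _∷_; _++_; concat; tabulate)
  open import Data.List.Relation.Unary.All using (All; []; _∷_)
  open import Data.List.Relation.Unary.All.Properties using (++⁺; concat⁺; tabulate⁺)
  open import Data.Product using (_×_; _,_; proj₁; proj₂; swap; ∃-syntax)
  open import Data.Sum using (_⊎_; inj₁; inj₂)
  import Data.Sum as Sum
  open import Data.Unit using (⊤; tt)
  open import Data.Empty using (⊥; ⊥-elim)
  open import Data.Bool.Properties using (∧-comm; ∧-commutativeMonoid; T-≡)
  open import Algebra.Bundles using (CommutativeMonoid)
  open import Algebra.Properties.CommutativeSemigroup (CommutativeMonoid.commutativeSemigroup ∧-commutativeMonoid)
    using (x∙yz≈y∙xz; x∙yz≈x∙zy)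
  open import Function using (_∘_; id; _⇔_; mk⇔; Equivalence; case_of_)
  open import Algebra.Bundles using (AbelianGroup)
  open import Relation.Nullary.Decidable using (does-⇔; dec-false; dec-true)
  open import Algebra.Structures using (IsAbelianGroup)
  open import Relation.Nullary using (¬_; does; yes; no; _×-dec_; _⊎-dec_)
  open import Relation.Unary using (Pred; Decidable)
  open import Level using (0ℓ)
  open import Relation.Binary.PropositionalEquality

  record HalvingGroup (n : ℕ) : Set where
    infixl 6 _⊕_ _⊖_
    field
      _⊕_            : Fin n → Fin n → Fin n
      0#             : Fin n
      -_             : Fin n → Fin n
      isAbelianGroup : IsAbelianGroup _≡_ _⊕_ 0# -_
      half           : Fin n → Fin n
      half-double    : ∀ a → half (a ⊕ a) ≡ a
      double-half    : ∀ a → half a ⊕ half a ≡ a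

    _⊖_ : Fin n → Fin n → Fin n
    a ⊖ b = a ⊕ - b

  Row : Set
  Row = Fin 3

  shift : Fin 2 → Row → Row
  shift 0F 0F = 1F
  shift 0F 1F = 2F
  shift 0F 2F = 0F
  shift 1F 0F = 2F
  shift 1F 1F = 0F
  shift 1F 2F = 1F

  shift-≢ : ∀ d i → shift d i ≢ i
  shift-≢ 0F 0F ()
  shift-≢ 0F 1F ()
  shift-≢ 0F 2F ()
  shift-≢ 1F 0F ()
  shift-≢ 1F 1F ()
  shift-≢ 1F 2F ()

  shift²-≢ : ∀ d i → shift d (shift d i) ≢ i
  shift²-≢ 0F 0F ()
  shift²-≢ 0F 1F ()
  shift²-≢ 0F 2F ()
  shift²-≢ 1F 0F ()
  shift²-≢ 1F 1F ()
  shift²-≢ 1F 2F ()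

  shift-inverse : ∀ d i → shift (opposite d) (shift d i) ≡ i
  shift-inverse 0F 0F = refl
  shift-inverse 0F 1F = refl
  shift-inverse 0F 2F = refl
  shift-inverse 1F 0F = refl
  shift-inverse 1F 1F = refl
  shift-inverse 1F 2F = refl

  shift-inverse′ : ∀ d i → shift d (shift (opposite d) i) ≡ i
  shift-inverse′ 0F 0F = refl
  shift-inverse′ 0F 1F = refl
  shift-inverse′ 0F 2F = refl
  shift-inverse′ 1F 0F = refl
  shift-inverse′ 1F 1F = refl
  shift-inverse′ 1F 2F = refl

  shift-injective : ∀ d {i j} → shift d i ≡ shift d j → i ≡ j
  shift-injective d {i} {j} e =
    trans (sym (shift-inverse d i)) (trans (cong (shift (opposite d)) e) (shift-inverse d j))

  shift-direction-injective : ∀ {d d′} j → shift d j ≡ shift d′ j → d ≡ d′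
  shift-direction-injective {0F} {0F} _  _  = refl
  shift-direction-injective {1F} {1F} _  _  = refl
  shift-direction-injective {0F} {1F} 0F ()
  shift-direction-injective {0F} {1F} 1F ()
  shift-direction-injective {0F} {1F} 2F ()
  shift-direction-injective {1F} {0F} 0F ()
  shift-direction-injective {1F} {0F} 1F ()
  shift-direction-injective {1F} {0F} 2F ()

  adjacent-rows : ∀ {j j′} → j ≢ j′ → ∃[ d ] j′ ≡ shift d j
  adjacent-rows {0F} {0F} j≢j′ = ⊥-elim (j≢j′ refl)
  adjacent-rows {0F} {1F} _    = 0F , refl
  adjacent-rows {0F} {2F} _    = 1F , refl
  adjacent-rows {1F} {0F} _    = 1F , refl
  adjacent-rows {1F} {1F} j≢j′ = ⊥-elim (j≢j′ refl)
  adjacent-rows {1F} {2F} _    = 0F , refl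
  adjacent-rows {2F} {0F} _    = 0F , refl
  adjacent-rows {2F} {1F} _    = 1F , refl
  adjacent-rows {2F} {2F} j≢j′ = ⊥-elim (j≢j′ refl)

  module _ {d : Fin 2} {i j : Row} {A B C D : Set} where

    slots-step : (j ≡ i × A) ⊎ (j ≡ shift d i × B) →
                 (shift d j ≡ i × C) ⊎ (shift d j ≡ shift d i × D) → j ≡ i × A × D
    slots-step (inj₁ (refl , a)) (inj₁ (e , _))  = ⊥-elim (shift-≢ d j e)
    slots-step (inj₁ (refl , a)) (inj₂ (_ , δ))  = refl , a , δ
    slots-step (inj₂ (refl , _)) (inj₁ (e , _))  = ⊥-elim (shift²-≢ d i e)
    slots-step (inj₂ (refl , _)) (inj₂ (e , _))  = ⊥-elim (shift-≢ d i (shift-injective d e))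

    slots-same-row : (j ≡ i × A) ⊎ (j ≡ shift d i × B) → (j ≡ i × C) ⊎ (j ≡ shift d i × D) →
                     (j ≡ i × A × C) ⊎ (j ≡ shift d i × B × D)
    slots-same-row (inj₁ (refl , a)) (inj₁ (_ , c)) = inj₁ (refl , a , c)
    slots-same-row (inj₁ (refl , _)) (inj₂ (e , _)) = ⊥-elim (shift-≢ d j (sym e))
    slots-same-row (inj₂ (refl , _)) (inj₁ (e , _)) = ⊥-elim (shift-≢ d i e)
    slots-same-row (inj₂ (refl , b)) (inj₂ (_ , δ)) = inj₂ (refl , b , δ)

  module Design {n} (G : HalvingGroup n) where

    open HalvingGroup G
    open IsAbelianGroup isAbelianGroup using (comm)

    private
      abelianGroup : AbelianGroup 0ℓ 0ℓ
      abelianGroup = record { isAbelianGroup = isAbelianGroup }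

    open import Algebra.Properties.AbelianGroup abelianGroup using (//-rightDividesˡ; //-rightDividesʳ)

    ⊕-solve : ∀ {a t c} → a ⊕ t ≡ c ⇔ a ≡ c ⊖ t
    ⊕-solve {a} {t} {c} = mk⇔ (λ e → trans (sym (//-rightDividesʳ t a)) (cong (_⊖ t) e))
                               λ a≡c⊖t → subst (λ x → x ⊕ t ≡ c) (sym a≡c⊖t) (//-rightDividesˡ t c)

    double-solve : ∀ {a r c} → a ⊕ a ⊕ r ≡ c ⇔ a ≡ half (c ⊖ r)
    double-solve {a} {r} {c} = mk⇔
      (λ e → trans (sym (half-double a)) (cong half (Equivalence.to ⊕-solve e)))
      λ a≡ → subst (λ x → x ⊕ x ⊕ r ≡ c) (sym a≡) (Equivalence.from ⊕-solve (double-half (c ⊖ r)))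

    ⊕⊕-solve : ∀ {x y r z} → x ⊕ y ⊕ r ≡ z ⇔ y ≡ z ⊖ r ⊖ x
    ⊕⊕-solve {x} {y} {r} {z} = mk⇔
      (λ e → Equivalence.to ⊕-solve (trans (comm y x) (Equivalence.to ⊕-solve e)))
      (λ e → Equivalence.from ⊕-solve (trans (comm x y) (Equivalence.from ⊕-solve e)))

    ⊕⊕-solveʳ : ∀ {x y r z} → y ⊕ x ⊕ r ≡ z ⇔ y ≡ z ⊖ r ⊖ x
    ⊕⊕-solveʳ {x} {y} {r} {z} = mk⇔
      (λ e → Equivalence.to ⊕⊕-solve (trans (cong (_⊕ r) (comm x y)) e))
      (λ e → trans (cong (_⊕ r) (comm y x)) (Equivalence.from ⊕⊕-solve e))

    complement-solve : ∀ {r a b e} → e ≡ r ⊖ (a ⊕ b) ⇔ a ≡ r ⊖ e ⊖ b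
    complement-solve {r} {a} {b} {e} = mk⇔
      (λ e≡ → Equivalence.to ⊕-solve (Equivalence.to ⊕-solve (trans (comm (a ⊕ b) e) (Equivalence.from ⊕-solve e≡))))
      (λ a≡ → Equivalence.to ⊕-solve (trans (comm e (a ⊕ b)) (Equivalence.from ⊕-solve (Equivalence.from ⊕-solve a≡))))

    complement-solveʳ : ∀ {r a b e} → e ≡ r ⊖ (a ⊕ b) ⇔ b ≡ r ⊖ e ⊖ a
    complement-solveʳ {r} {a} {b} {e} = mk⇔
      (λ e≡ → Equivalence.to complement-solve (trans e≡ (cong (r ⊖_) (comm a b))))
      (λ b≡ → trans (Equivalence.from complement-solve b≡) (cong (r ⊖_) (comm b a)))

    translation-unique : ∀ t z → # (λ r → z ≟ t ⊕ r) ≡ 1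
    translation-unique t z = #-unique (λ r → z ≟ t ⊕ r) (z ⊖ t)
      (sym (trans (comm t (z ⊖ t)) (Equivalence.from ⊕-solve refl)))
      λ r z≡ → Equivalence.to ⊕-solve (trans (comm r t) (sym z≡))

    subtraction-unique : ∀ t z → # (λ r → z ≟ r ⊖ t) ≡ 1
    subtraction-unique t z = #-unique (λ r → z ≟ r ⊖ t) (z ⊕ t) (sym (//-rightDividesʳ t z))
      λ r z≡ → sym (trans (cong (_⊕ t) z≡) (//-rightDividesˡ t r))

    Z : Set
    Z = Fin n

    data Pt : Set where
      ⟨_,_⟩ : Row → Z → Pt
      ∞     : Fin 2 → Pt

    Big : Row → Pred Pt 0ℓ
    Big i ⟨ j , _ ⟩ = j ≡ i
    Big i (∞ _)     = ⊤

    Tri : Fin 2 → Z → Row → Z → Pred Pt 0ℓ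
    Tri d r i a ⟨ j , c ⟩ = (j ≡ i × c ≡ a) ⊎ (j ≡ shift d i × c ≡ a ⊕ a ⊕ r)
    Tri d r i a (∞ e)     = e ≡ d

    Wedge : Fin 2 → Z → Row → Z → Z → Pred Pt 0ℓ
    Wedge d r i y y′ ⟨ j , c ⟩ = (j ≡ i × (c ≡ y ⊎ c ≡ y′)) ⊎ (j ≡ shift d i × c ≡ y ⊕ y′ ⊕ r)
    Wedge d r i y y′ (∞ _)     = ⊥

    transversal-coord : Z → Z → Z → Row → Z
    transversal-coord r a b 0F = a
    transversal-coord r a b 1F = b
    transversal-coord r a b 2F = r ⊖ (a ⊕ b)

    Transversal : Z → Z → Z → Pred Pt 0ℓ
    Transversal r a b ⟨ j , c ⟩ = c ≡ transversal-coord r a b j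
    Transversal r a b (∞ _)     = ⊥

    Big? : ∀ i → Decidable (Big i)
    Big? i ⟨ j , _ ⟩ = j ≟ i
    Big? i (∞ _)     = yes tt

    Tri? : ∀ d r i a → Decidable (Tri d r i a)
    Tri? d r i a ⟨ j , c ⟩ = (j ≟ i ×-dec c ≟ a) ⊎-dec (j ≟ shift d i ×-dec c ≟ a ⊕ a ⊕ r)
    Tri? d r i a (∞ e)     = e ≟ d

    Wedge? : ∀ d r i y y′ → Decidable (Wedge d r i y y′)
    Wedge? d r i y y′ ⟨ j , c ⟩ =
      (j ≟ i ×-dec (c ≟ y ⊎-dec c ≟ y′)) ⊎-dec (j ≟ shift d i ×-dec c ≟ y ⊕ y′ ⊕ r)
    Wedge? d r i y y′ (∞ _) = no λ ()

    Transversal? : ∀ r a b → Decidable (Transversal r a b)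
    Transversal? r a b ⟨ j , c ⟩ = c ≟ transversal-coord r a b j
    Transversal? r a b (∞ _)     = no λ ()

    Blk : Set
    Blk = Pt → Bool

    ⌊_⌋ : ∀ {P : Pred Pt 0ℓ} → Decidable P → Blk
    ⌊ P? ⌋ p = does (P? p)

    bigs : List Blk
    bigs = tabulate λ i → ⌊ Big? i ⌋

    wedge-if : Z → Fin 2 → Row → Z → Z → List Blk
    wedge-if r d i y y′ = if does (y <? y′) then ⌊ Wedge? d r i y y′ ⌋ ∷ [] else []

    tri-blocks transversal-blocks wedge-blocks small-blocks : Z → List Blk
    tri-blocks r = concat (tabulate λ d → concat (tabulate λ i → tabulate λ a → ⌊ Tri? d r i a ⌋))
    transversal-blocks r = concat (tabulate λ a → tabulate λ b → ⌊ Transversal? r a b ⌋)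
    wedge-blocks r =
      concat (tabulate λ d → concat (tabulate λ i → concat (tabulate λ y → concat (tabulate (wedge-if r d i y)))))
    small-blocks r = tri-blocks r ++ transversal-blocks r ++ wedge-blocks r

    design : Z → List Blk
    design r = bigs ++ small-blocks r

    module _ (P : Blk → Bool) (r : Z) where

      count-design : count P (design r) ≡
        sum (λ i → ⟦ P ⌊ Big? i ⌋ ⟧) +
        (sum (λ d → sum λ i → sum λ a → ⟦ P ⌊ Tri? d r i a ⌋ ⟧) +
        (sum (λ a → sum λ b → ⟦ P ⌊ Transversal? r a b ⌋ ⟧) +
         sum (λ d → sum λ i → sum λ y → sum λ y′ → ⟦ does (y <? y′) ∧ P ⌊ Wedge? d r i y y′ ⌋ ⟧)))
      count-design = begin
        count P (bigs ++ small-blocks r)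
          ≡⟨ count-++ P bigs (small-blocks r) ⟩
        count P bigs + count P (small-blocks r)
          ≡⟨ cong (count P bigs +_) (count-++ P (tri-blocks r) _) ⟩
        count P bigs + (count P (tri-blocks r) + count P (transversal-blocks r ++ wedge-blocks r))
          ≡⟨ cong (λ t → count P bigs + (count P (tri-blocks r) + t)) (count-++ P (transversal-blocks r) _) ⟩
        count P bigs + (count P (tri-blocks r) + (count P (transversal-blocks r) + count P (wedge-blocks r)))
          ≡⟨ cong₂ _+_ (count-tabulate P (λ i → ⌊ Big? i ⌋)) (cong₂ _+_ tris-sum (cong₂ _+_ transversals-sum wedges-sum)) ⟩
        _ ∎
        where
          open ≡-Reasoning
          tris-sum : count P (tri-blocks r) ≡ sum (λ d → sum λ i → sum λ a → ⟦ P ⌊ Tri? d r i a ⌋ ⟧)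
          tris-sum = trans (count-concat-tabulate P λ d → concat (tabulate λ i → tabulate λ a → ⌊ Tri? d r i a ⌋))
                     (sum-cong-≗ λ d → trans (count-concat-tabulate P λ i → tabulate λ a → ⌊ Tri? d r i a ⌋)
                     (sum-cong-≗ λ i → count-tabulate P λ a → ⌊ Tri? d r i a ⌋))
          transversals-sum : count P (transversal-blocks r) ≡ sum (λ a → sum λ b → ⟦ P ⌊ Transversal? r a b ⌋ ⟧)
          transversals-sum = trans (count-concat-tabulate P λ a → tabulate λ b → ⌊ Transversal? r a b ⌋)
                             (sum-cong-≗ λ a → count-tabulate P λ b → ⌊ Transversal? r a b ⌋)
          wedges-sum : count P (wedge-blocks r) ≡
                       sum (λ d → sum λ i → sum λ y → sum λ y′ → ⟦ does (y <? y′) ∧ P ⌊ Wedge? d r i y y′ ⌋ ⟧)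
          wedges-sum =
            trans (count-concat-tabulate P λ d → concat (tabulate λ i → concat (tabulate λ y → concat (tabulate (wedge-if r d i y)))))
            (sum-cong-≗ λ d → trans (count-concat-tabulate P λ i → concat (tabulate λ y → concat (tabulate (wedge-if r d i y))))
            (sum-cong-≗ λ i → trans (count-concat-tabulate P λ y → concat (tabulate (wedge-if r d i y)))
            (sum-cong-≗ λ y → trans (count-concat-tabulate P (wedge-if r d i y))
            (sum-cong-≗ λ y′ → count-if P (does (y <? y′)) ⌊ Wedge? d r i y y′ ⌋))))

    #big : Pt → Pt → ℕ
    #big p q = # λ i → Big? i p ×-dec Big? i q

    tri₂? : ∀ d r p q i → Decidable λ a → Tri d r i a p × Tri d r i a q
    tri₂? d r p q i a = Tri? d r i a p ×-dec Tri? d r i a q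

    #tri : Fin 2 → Z → Pt → Pt → ℕ
    #tri d r p q = sum λ i → # tri₂? d r p q i

    transversal₂? : ∀ r p q a → Decidable λ b → Transversal r a b p × Transversal r a b q
    transversal₂? r p q a b = Transversal? r a b p ×-dec Transversal? r a b q

    #transversal : Z → Pt → Pt → ℕ
    #transversal r p q = sum λ a → # transversal₂? r p q a

    wedge₂? : ∀ d r p q i y → Decidable λ y′ → y < y′ × Wedge d r i y y′ p × Wedge d r i y y′ q
    wedge₂? d r p q i y y′ = y <? y′ ×-dec (Wedge? d r i y y′ p ×-dec Wedge? d r i y y′ q)

    #wedge : Fin 2 → Z → Pt → Pt → ℕ
    #wedge d r p q = sum λ i → sum λ y → # wedge₂? d r p q i y

    #big-∞∞ : ∀ e e′ → #big (∞ e) (∞ e′) ≡ 3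
    #big-∞∞ e e′ = refl

    #big-∞-pt : ∀ e j c → #big (∞ e) ⟨ j , c ⟩ ≡ 1
    #big-∞-pt e j c = #-unique (λ i → Big? i (∞ e) ×-dec Big? i ⟨ j , c ⟩) j (tt , refl) λ { i (_ , refl) → refl }

    #big-same-row : ∀ j c c′ → #big ⟨ j , c ⟩ ⟨ j , c′ ⟩ ≡ 1
    #big-same-row j c c′ = #-unique (λ i → Big? i ⟨ j , c ⟩ ×-dec Big? i ⟨ j , c′ ⟩) j (refl , refl) λ { i (refl , _) → refl }

    #big-other-rows : ∀ {j j′} c c′ → j ≢ j′ → #big ⟨ j , c ⟩ ⟨ j′ , c′ ⟩ ≡ 0
    #big-other-rows {j} {j′} c c′ j≢j′ =
      #-none (λ i → Big? i ⟨ j , c ⟩ ×-dec Big? i ⟨ j′ , c′ ⟩) λ i (j≡i , j′≡i) → j≢j′ (trans j≡i (sym j′≡i))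

    tri-step : ∀ d r j c c′ → #tri d r ⟨ j , c ⟩ ⟨ shift d j , c′ ⟩ ≡ ⟦ does (c′ ≟ c ⊕ c ⊕ r) ⟧
    tri-step d r j c c′ = ∑#-solve (tri₂? d r ⟨ j , c ⟩ ⟨ shift d j , c′ ⟩) j c only at-solution (c′ ≟ c ⊕ c ⊕ r)
      where
        only : ∀ i a → Tri d r i a ⟨ j , c ⟩ × Tri d r i a ⟨ shift d j , c′ ⟩ → i ≡ j × a ≡ c
        only i a (m₁ , m₂) with slots-step m₁ m₂
        ... | refl , refl , _ = refl , refl
        at-solution : (Tri d r j c ⟨ j , c ⟩ × Tri d r j c ⟨ shift d j , c′ ⟩) ⇔ c′ ≡ c ⊕ c ⊕ r
        at-solution = mk⇔ (λ (m₁ , m₂) → proj₂ (proj₂ (slots-step m₁ m₂)))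
                           λ e → inj₁ (refl , refl) , inj₂ (refl , e)

    tri-∞-pt : ∀ d r j c → #tri d r (∞ d) ⟨ j , c ⟩ ≡ 2
    tri-∞-pt d r j c = begin
      #tri d r (∞ d) ⟨ j , c ⟩
        ≡⟨ ∑#-cong (tri₂? d r (∞ d) ⟨ j , c ⟩) (λ i a → base? i a ⊎-dec shifted? i a)
                                                                (λ i a → mk⇔ proj₂ (refl ,_)) ⟩
      sum (λ i → # λ a → base? i a ⊎-dec shifted? i a) ≡⟨ ∑#-⊎ base? shifted? disjoint ⟩
      sum (λ i → # base? i) + sum (λ i → # shifted? i) ≡⟨ cong₂ _+_ base-once shifted-once ⟩
      2                                              ∎
      where
        open ≡-Reasoning
        base? : ∀ i → Decidable λ a → j ≡ i × c ≡ a
        base? i a = j ≟ i ×-dec c ≟ a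
        shifted? : ∀ i → Decidable λ a → j ≡ shift d i × c ≡ a ⊕ a ⊕ r
        shifted? i a = j ≟ shift d i ×-dec c ≟ a ⊕ a ⊕ r
        disjoint : ∀ i a → j ≡ i × c ≡ a → ¬ (j ≡ shift d i × c ≡ a ⊕ a ⊕ r)
        disjoint i a (refl , _) (e , _) = shift-≢ d j (sym e)
        base-once : sum (λ i → # base? i) ≡ 1
        base-once = ∑#-unique base? j c (refl , refl) λ { i a (refl , refl) → refl , refl }
        shifted-once : sum (λ i → # shifted? i) ≡ 1
        shifted-once = ∑#-unique shifted? (shift (opposite d) j) (half (c ⊖ r))
          (sym (shift-inverse′ d j) , sym (Equivalence.from double-solve refl))
          λ { i a (refl , e) → sym (shift-inverse d i) , Equivalence.to double-solve (sym e) }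

    #tri-sym : ∀ d r p q → #tri d r p q ≡ #tri d r q p
    #tri-sym d r p q = ∑#-cong (tri₂? d r p q) (tri₂? d r q p) λ _ _ → mk⇔ swap swap

    tri-∞∞ : ∀ d r {e e′} → e ≢ e′ → #tri d r (∞ e) (∞ e′) ≡ 0
    tri-∞∞ d r {e} {e′} e≢e′ = ∑#-none (tri₂? d r (∞ e) (∞ e′)) λ i a (e≡d , e′≡d) → e≢e′ (trans e≡d (sym e′≡d))

    tri-∞-other : ∀ d r e q → e ≢ d → #tri d r (∞ e) q ≡ 0
    tri-∞-other d r e q e≢d = ∑#-none (tri₂? d r (∞ e) q) λ i a (e≡d , _) → e≢d e≡d

    private
      coincide : ∀ {A B : Set} {x y u v : Z} → (A × x ≡ u × y ≡ u) ⊎ (B × x ≡ v × y ≡ v) → x ≡ y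
      coincide (inj₁ (_ , x≡u , y≡u)) = trans x≡u (sym y≡u)
      coincide (inj₂ (_ , x≡v , y≡v)) = trans x≡v (sym y≡v)

    tri-same-row : ∀ d r j {c c′} → c ≢ c′ → #tri d r ⟨ j , c ⟩ ⟨ j , c′ ⟩ ≡ 0
    tri-same-row d r j {c} {c′} c≢c′ =
      ∑#-none (tri₂? d r ⟨ j , c ⟩ ⟨ j , c′ ⟩) λ i a (m₁ , m₂) → c≢c′ (coincide (slots-same-row m₁ m₂))

    #tris : Z → Pt → Pt → ℕ
    #tris r p q = sum λ d → #tri d r p q

    tris-∞∞ : ∀ r {e e′} → e ≢ e′ → #tris r (∞ e) (∞ e′) ≡ 0
    tris-∞∞ r e≢e′ = ∑-zero λ d → tri-∞∞ d r e≢e′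

    tris-∞-pt : ∀ r e j c → #tris r (∞ e) ⟨ j , c ⟩ ≡ 2
    tris-∞-pt r e j c = trans (∑-support e λ d d≢e → tri-∞-other d r e ⟨ j , c ⟩ (d≢e ∘ sym)) (tri-∞-pt e r j c)

    tris-same-row : ∀ r j {c c′} → c ≢ c′ → #tris r ⟨ j , c ⟩ ⟨ j , c′ ⟩ ≡ 0
    tris-same-row r j c≢c′ = ∑-zero λ d → tri-same-row d r j c≢c′

    tris-step : ∀ r j c c′ → #tris r ⟨ j , c ⟩ ⟨ shift 0F j , c′ ⟩ ≡
                ⟦ does (c′ ≟ c ⊕ c ⊕ r) ⟧ + (⟦ does (c ≟ c′ ⊕ c′ ⊕ r) ⟧ + 0)
    tris-step r j c c′ = cong₂ _+_ (tri-step 0F r j c c′) (cong (_+ 0) backward)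
      where
        backward : #tri 1F r ⟨ j , c ⟩ ⟨ shift 0F j , c′ ⟩ ≡ ⟦ does (c ≟ c′ ⊕ c′ ⊕ r) ⟧
        backward = trans (#tri-sym 1F r ⟨ j , c ⟩ ⟨ shift 0F j , c′ ⟩)
          (subst (λ k → #tri 1F r ⟨ shift 0F j , c′ ⟩ ⟨ k , c ⟩ ≡ ⟦ does (c ≟ c′ ⊕ c′ ⊕ r) ⟧)
                 (shift-inverse 0F j) (tri-step 1F r (shift 0F j) c′ c))

    transversal-∞ : ∀ r e q → #transversal r (∞ e) q ≡ 0
    transversal-∞ r e q = ∑#-none (transversal₂? r (∞ e) q) λ { a b (() , _) }

    transversal-same-row : ∀ r j {c c′} → c ≢ c′ → #transversal r ⟨ j , c ⟩ ⟨ j , c′ ⟩ ≡ 0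
    transversal-same-row r j {c} {c′} c≢c′ =
      ∑#-none (transversal₂? r ⟨ j , c ⟩ ⟨ j , c′ ⟩) λ a b (c≡ , c′≡) → c≢c′ (trans c≡ (sym c′≡))

    transversal-step : ∀ r j c c′ → #transversal r ⟨ j , c ⟩ ⟨ shift 0F j , c′ ⟩ ≡ 1
    transversal-step r 0F c c′ =
      ∑#-unique (transversal₂? r ⟨ 0F , c ⟩ ⟨ 1F , c′ ⟩) c c′ (refl , refl)
        λ { a b (refl , refl) → refl , refl }
    transversal-step r 1F c c′ =
      ∑#-unique (transversal₂? r ⟨ 1F , c ⟩ ⟨ 2F , c′ ⟩) (r ⊖ c′ ⊖ c) c
        (refl , Equivalence.from complement-solve refl)
        λ { a b (refl , c′≡) → Equivalence.to complement-solve c′≡ , refl }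
    transversal-step r 2F c c′ =
      ∑#-unique (transversal₂? r ⟨ 2F , c ⟩ ⟨ 0F , c′ ⟩) c′ (r ⊖ c ⊖ c′)
        (Equivalence.from complement-solveʳ refl , refl)
        λ { a b (c≡ , refl) → refl , Equivalence.to complement-solveʳ c≡ }

    private
      wedge-at-row : ∀ d r p q j → (∀ i y y′ → y < y′ × Wedge d r i y y′ p × Wedge d r i y y′ q → i ≡ j) →
                     #wedge d r p q ≡ sum (λ y → # wedge₂? d r p q j y)
      wedge-at-row d r p q j only =
        ∑-support j λ i i≢j → ∑#-none (wedge₂? d r p q i) λ y y′ w → i≢j (only i y y′ w)

    wedge-∞ : ∀ d r e q → #wedge d r (∞ e) q ≡ 0
    wedge-∞ d r e q = ∑-zero λ i → ∑#-none (wedge₂? d r (∞ e) q i) λ { y y′ (_ , () , _) }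

    private
      same-row-pair : ∀ {d r j y y′ c c′} → c ≢ c′ → Wedge d r j y y′ ⟨ j , c ⟩ → Wedge d r j y y′ ⟨ j , c′ ⟩ →
                      UnorderedPair c c′ y y′
      same-row-pair {d} {j = j} c≢c′ m₁ m₂ with slots-same-row m₁ m₂
      ... | inj₁ (_ , inj₁ c≡y  , inj₂ c′≡y′) = inj₁ (c≡y , c′≡y′)
      ... | inj₁ (_ , inj₂ c≡y′ , inj₁ c′≡y)  = inj₂ (c≡y′ , c′≡y)
      ... | inj₁ (_ , inj₁ c≡y  , inj₁ c′≡y)  = ⊥-elim (c≢c′ (trans c≡y (sym c′≡y)))
      ... | inj₁ (_ , inj₂ c≡y′ , inj₂ c′≡y′) = ⊥-elim (c≢c′ (trans c≡y′ (sym c′≡y′)))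
      ... | inj₂ (j≡shift , _)                = ⊥-elim (shift-≢ d j (sym j≡shift))

      same-row-members : ∀ {d r j y y′ c c′} → UnorderedPair c c′ y y′ →
                         Wedge d r j y y′ ⟨ j , c ⟩ × Wedge d r j y y′ ⟨ j , c′ ⟩
      same-row-members (inj₁ (c≡y , c′≡y′)) = inj₁ (refl , inj₁ c≡y) , inj₁ (refl , inj₂ c′≡y′)
      same-row-members (inj₂ (c≡y′ , c′≡y)) = inj₁ (refl , inj₂ c≡y′) , inj₁ (refl , inj₁ c′≡y)

    wedge-same-row : ∀ d r j {c c′} → c ≢ c′ → #wedge d r ⟨ j , c ⟩ ⟨ j , c′ ⟩ ≡ 1
    wedge-same-row d r j {c} {c′} c≢c′ = begin
      #wedge d r ⟨ j , c ⟩ ⟨ j , c′ ⟩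
        ≡⟨ wedge-at-row d r ⟨ j , c ⟩ ⟨ j , c′ ⟩ j (λ i y y′ (_ , m₁ , m₂) → row (slots-same-row m₁ m₂)) ⟩
      sum (λ y → # wedge₂? d r ⟨ j , c ⟩ ⟨ j , c′ ⟩ j y)
        ≡⟨ ∑#-cong (wedge₂? d r ⟨ j , c ⟩ ⟨ j , c′ ⟩ j) (λ y y′ → y <? y′ ×-dec unorderedPair? c c′ y y′)
                   (λ y y′ → mk⇔ (λ (y<y′ , m₁ , m₂) → y<y′ , same-row-pair c≢c′ m₁ m₂)
                                  (λ (y<y′ , u) → y<y′ , same-row-members u)) ⟩
      sum (λ y → # λ y′ → y <? y′ ×-dec unorderedPair? c c′ y y′)
        ≡⟨ #-unordered-pair c c′ ⟩
      ⟦ not (does (c ≟ c′)) ⟧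
        ≡⟨ cong (⟦_⟧ ∘ not) (dec-false (c ≟ c′) c≢c′) ⟩
      1 ∎
      where
        open ≡-Reasoning
        row : ∀ {i y y′} → (j ≡ i × _) ⊎ (j ≡ shift d i × c ≡ y ⊕ y′ ⊕ r × c′ ≡ y ⊕ y′ ⊕ r) → i ≡ j
        row (inj₁ (j≡i , _)) = sym j≡i
        row (inj₂ (_ , c≡ , c′≡)) = ⊥-elim (c≢c′ (trans c≡ (sym c′≡)))

    wedge-step : ∀ d r j c c′ → #wedge d r ⟨ j , c ⟩ ⟨ shift d j , c′ ⟩ ≡ ⟦ not (does (c′ ≟ c ⊕ c ⊕ r)) ⟧
    wedge-step d r j c c′ = begin
      #wedge d r ⟨ j , c ⟩ ⟨ shift d j , c′ ⟩
        ≡⟨ wedge-at-row d r ⟨ j , c ⟩ ⟨ shift d j , c′ ⟩ j (λ i y y′ (_ , m₁ , m₂) → sym (proj₁ (slots-step m₁ m₂))) ⟩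
      sum (λ y → # wedge₂? d r ⟨ j , c ⟩ ⟨ shift d j , c′ ⟩ j y)
        ≡⟨ ∑#-cong (wedge₂? d r ⟨ j , c ⟩ ⟨ shift d j , c′ ⟩ j) (λ y y′ → y <? y′ ×-dec unorderedPair? c e y y′)
                   (λ y y′ → mk⇔ (λ (y<y′ , m₁ , m₂) → y<y′ , pair (proj₂ (slots-step m₁ m₂)))
                                  (λ (y<y′ , u) → y<y′ , members u)) ⟩
      sum (λ y → # λ y′ → y <? y′ ×-dec unorderedPair? c e y y′)
        ≡⟨ #-unordered-pair c e ⟩
      ⟦ not (does (c ≟ e)) ⟧
        ≡⟨ cong (⟦_⟧ ∘ not) (does-⇔ (mk⇔ (sym ∘ Equivalence.from ⊕⊕-solve) (Equivalence.to ⊕⊕-solve ∘ sym))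
                                    (c ≟ e) (c′ ≟ c ⊕ c ⊕ r)) ⟩
      ⟦ not (does (c′ ≟ c ⊕ c ⊕ r)) ⟧ ∎
      where
        open ≡-Reasoning
        e : Z
        e = c′ ⊖ r ⊖ c
        pair : ∀ {y y′} → (c ≡ y ⊎ c ≡ y′) × c′ ≡ y ⊕ y′ ⊕ r → UnorderedPair c e y y′
        pair (inj₁ refl , c′≡) = inj₁ (refl , sym (Equivalence.to ⊕⊕-solve (sym c′≡)))
        pair (inj₂ refl , c′≡) = inj₂ (refl , sym (Equivalence.to ⊕⊕-solveʳ (sym c′≡)))
        members : ∀ {y y′} → UnorderedPair c e y y′ → Wedge d r j y y′ ⟨ j , c ⟩ × Wedge d r j y y′ ⟨ shift d j , c′ ⟩
        members (inj₁ (refl , e≡y′)) = inj₁ (refl , inj₁ refl) , inj₂ (refl , sym (Equivalence.from ⊕⊕-solve (sym e≡y′)))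
        members (inj₂ (refl , e≡y))  = inj₁ (refl , inj₂ refl) , inj₂ (refl , sym (Equivalence.from ⊕⊕-solveʳ (sym e≡y)))

    #wedge-sym : ∀ d r p q → #wedge d r p q ≡ #wedge d r q p
    #wedge-sym d r p q = sum-cong-≗ λ i → ∑#-cong (wedge₂? d r p q i) (wedge₂? d r q p i)
      λ _ _ → mk⇔ (λ (y<y′ , m) → y<y′ , swap m) (λ (y<y′ , m) → y<y′ , swap m)

    #wedges : Z → Pt → Pt → ℕ
    #wedges r p q = sum λ d → #wedge d r p q

    wedges-∞ : ∀ r e q → #wedges r (∞ e) q ≡ 0
    wedges-∞ r e q = ∑-zero λ d → wedge-∞ d r e q

    wedges-same-row : ∀ r j {c c′} → c ≢ c′ → #wedges r ⟨ j , c ⟩ ⟨ j , c′ ⟩ ≡ 2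
    wedges-same-row r j c≢c′ = cong₂ _+_ (wedge-same-row 0F r j c≢c′) (cong (_+ 0) (wedge-same-row 1F r j c≢c′))

    wedges-step : ∀ r j c c′ → #wedges r ⟨ j , c ⟩ ⟨ shift 0F j , c′ ⟩ ≡
                  ⟦ not (does (c′ ≟ c ⊕ c ⊕ r)) ⟧ + (⟦ not (does (c ≟ c′ ⊕ c′ ⊕ r)) ⟧ + 0)
    wedges-step r j c c′ = cong₂ _+_ (wedge-step 0F r j c c′) (cong (_+ 0) backward)
      where
        backward : #wedge 1F r ⟨ j , c ⟩ ⟨ shift 0F j , c′ ⟩ ≡ ⟦ not (does (c ≟ c′ ⊕ c′ ⊕ r)) ⟧
        backward = trans (#wedge-sym 1F r ⟨ j , c ⟩ ⟨ shift 0F j , c′ ⟩)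
          (subst (λ k → #wedge 1F r ⟨ shift 0F j , c′ ⟩ ⟨ k , c ⟩ ≡ ⟦ not (does (c ≟ c′ ⊕ c′ ⊕ r)) ⟧)
                 (shift-inverse 0F j) (wedge-step 1F r (shift 0F j) c′ c))

    Through₂ : Pt → Pt → Blk → Bool
    Through₂ p q χ = χ p ∧ χ q

    count-through₂ : ∀ r p q → count (Through₂ p q) (design r) ≡
                     #big p q + (#tris r p q + (#transversal r p q + #wedges r p q))
    count-through₂ r p q = count-design (Through₂ p q) r

    through₂-sym : ∀ r p q → count (Through₂ p q) (design r) ≡ count (Through₂ q p) (design r)
    through₂-sym r p q = count-cong-∈ (design r) λ {χ} _ → ∧-comm (χ p) (χ q)

    private
      step-total : ∀ x y → 0 + ((⟦ x ⟧ + (⟦ y ⟧ + 0)) + (1 + (⟦ not x ⟧ + (⟦ not y ⟧ + 0)))) ≡ 3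
      step-total true  true  = refl
      step-total true  false = refl
      step-total false true  = refl
      step-total false false = refl

    pair-count-step : ∀ r j c c′ → count (Through₂ ⟨ j , c ⟩ ⟨ shift 0F j , c′ ⟩) (design r) ≡ 3
    pair-count-step r j c c′ = begin
      count (Through₂ ⟨ j , c ⟩ ⟨ shift 0F j , c′ ⟩) (design r)
        ≡⟨ count-through₂ r ⟨ j , c ⟩ ⟨ shift 0F j , c′ ⟩ ⟩
      _ ≡⟨ cong₂ _+_ (#big-other-rows c c′ (shift-≢ 0F j ∘ sym))
                     (cong₂ _+_ (tris-step r j c c′) (cong₂ _+_ (transversal-step r j c c′) (wedges-step r j c c′))) ⟩
      _ ≡⟨ step-total (does (c′ ≟ c ⊕ c ⊕ r)) (does (c ≟ c′ ⊕ c′ ⊕ r)) ⟩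
      3 ∎
      where open ≡-Reasoning

    pair-count : ∀ r {p q} → p ≢ q → count (Through₂ p q) (design r) ≡ 3
    pair-count r {∞ e} {∞ e′} p≢q =
      trans (count-through₂ r (∞ e) (∞ e′))
            (cong₂ _+_ (#big-∞∞ e e′) (cong₂ _+_ (tris-∞∞ r (p≢q ∘ cong ∞))
                                     (cong₂ _+_ (transversal-∞ r e (∞ e′)) (wedges-∞ r e (∞ e′)))))
    pair-count r {∞ e} {⟨ j , c ⟩} _ =
      trans (count-through₂ r (∞ e) ⟨ j , c ⟩)
            (cong₂ _+_ (#big-∞-pt e j c) (cong₂ _+_ (tris-∞-pt r e j c)
                                        (cong₂ _+_ (transversal-∞ r e ⟨ j , c ⟩) (wedges-∞ r e ⟨ j , c ⟩))))
    pair-count r {⟨ j , c ⟩} {∞ e} p≢q =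
      trans (through₂-sym r ⟨ j , c ⟩ (∞ e)) (pair-count r (p≢q ∘ sym))
    pair-count r {⟨ j , c ⟩} {⟨ j′ , c′ ⟩} p≢q with j ≟ j′
    ... | yes refl =
      trans (count-through₂ r ⟨ j , c ⟩ ⟨ j , c′ ⟩)
            (cong₂ _+_ (#big-same-row j c c′) (cong₂ _+_ (tris-same-row r j c≢c′)
                                             (cong₂ _+_ (transversal-same-row r j c≢c′) (wedges-same-row r j c≢c′))))
      where c≢c′ = p≢q ∘ cong ⟨ j ,_⟩
    ... | no j≢j′ with adjacent-rows j≢j′
    ...   | 0F     , refl = pair-count-step r j c c′
    ...   | 1F , refl =
      trans (through₂-sym r ⟨ j , c ⟩ ⟨ shift 1F j , c′ ⟩)
            (subst (λ k → count (Through₂ ⟨ shift 1F j , c′ ⟩ ⟨ k , c ⟩) (design r) ≡ 3)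
                   (shift-inverse′ 0F j) (pair-count-step r (shift 1F j) c′ c))

    #big₃ : Pt → Pt → Pt → ℕ
    #big₃ p q s = # λ i → Big? i p ×-dec (Big? i q ×-dec Big? i s)

    tri₃? : ∀ d r p q s i → Decidable λ a → Tri d r i a p × Tri d r i a q × Tri d r i a s
    tri₃? d r p q s i a = Tri? d r i a p ×-dec (Tri? d r i a q ×-dec Tri? d r i a s)

    #tris₃ : Z → Pt → Pt → Pt → ℕ
    #tris₃ r p q s = sum λ d → sum λ i → # tri₃? d r p q s i

    transversal₃? : ∀ r p q s a → Decidable λ b → Transversal r a b p × Transversal r a b q × Transversal r a b s
    transversal₃? r p q s a b = Transversal? r a b p ×-dec (Transversal? r a b q ×-dec Transversal? r a b s)

    #transversal₃ : Z → Pt → Pt → Pt → ℕ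
    #transversal₃ r p q s = sum λ a → # transversal₃? r p q s a

    wedge₃? : ∀ d r p q s i y → Decidable λ y′ →
              y < y′ × Wedge d r i y y′ p × Wedge d r i y y′ q × Wedge d r i y y′ s
    wedge₃? d r p q s i y y′ = y <? y′ ×-dec (Wedge? d r i y y′ p ×-dec (Wedge? d r i y y′ q ×-dec Wedge? d r i y y′ s))

    #wedge₃ : Fin 2 → Z → Pt → Pt → Pt → ℕ
    #wedge₃ d r p q s = sum λ i → sum λ y → # wedge₃? d r p q s i y

    #wedges₃ : Z → Pt → Pt → Pt → ℕ
    #wedges₃ r p q s = sum λ d → #wedge₃ d r p q s

    Through₃ : Pt → Pt → Pt → Blk → Bool
    Through₃ p q s χ = χ p ∧ χ q ∧ χ s

    count-through₃ : ∀ r p q s → count (Through₃ p q s) (design r) ≡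
                     #big₃ p q s + (#tris₃ r p q s + (#transversal₃ r p q s + #wedges₃ r p q s))
    count-through₃ r p q s = count-design (Through₃ p q s) r

    InBig : Row → Pt → Pt → Pt → Set
    InBig i p q s = Big i p × Big i q × Big i s

    data Cover (p q s : Pt) : Set where
      in-big   : ∀ i → InBig i p q s → (∀ r → count (Through₃ p q s) (design r) ≡ 1) → Cover p q s
      in-small : (∀ i → ¬ InBig i p q s) → sum (λ r → count (Through₃ p q s) (design r)) ≡ 1 → Cover p q s

    private
      permuted : ∀ {p q s p′ q′ s′} → (∀ χ → Through₃ p q s χ ≡ Through₃ p′ q′ s′ χ) →
                 (∀ {i} → InBig i p q s → InBig i p′ q′ s′) → (∀ {i} → InBig i p′ q′ s′ → InBig i p q s) →
                 Cover p q s → Cover p′ q′ s′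
      permuted same to from (in-big i big once) =
        in-big i (to big) λ r → trans (count-cong-∈ (design r) λ {χ} _ → sym (same χ)) (once r)
      permuted same to from (in-small ¬big once) =
        in-small (λ i → ¬big i ∘ from) (trans (sum-cong-≗ λ r → count-cong-∈ (design r) λ {χ} _ → sym (same χ)) once)

    cover-swap₁₂ : ∀ {p q s} → Cover p q s → Cover q p s
    cover-swap₁₂ {p} {q} {s} = permuted (λ χ → x∙yz≈y∙xz (χ p) (χ q) (χ s))
      (λ (a , b , c) → b , a , c) (λ (b , a , c) → a , b , c)

    cover-swap₂₃ : ∀ {p q s} → Cover p q s → Cover p s q
    cover-swap₂₃ {p} {q} {s} = permuted (λ χ → x∙yz≈x∙zy (χ p) (χ q) (χ s))
      (λ (a , b , c) → a , c , b) (λ (a , c , b) → a , b , c)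

    private
      transversal₃-∞ : ∀ r e q s → #transversal₃ r (∞ e) q s ≡ 0
      transversal₃-∞ r e q s = ∑#-none (transversal₃? r (∞ e) q s) λ { a b (() , _) }

      wedges₃-∞ : ∀ r e q s → #wedges₃ r (∞ e) q s ≡ 0
      wedges₃-∞ r e q s = ∑-zero λ d → ∑-zero λ i → ∑#-none (wedge₃? d r (∞ e) q s i) λ { y y′ (_ , () , _) }

    cover-∞∞ : ∀ {e e′} → e ≢ e′ → ∀ j c → Cover (∞ e) (∞ e′) ⟨ j , c ⟩
    cover-∞∞ {e} {e′} e≢e′ j c = in-big j (tt , tt , refl) λ r →
      trans (count-through₃ r (∞ e) (∞ e′) ⟨ j , c ⟩)
            (cong₂ _+_ (#-unique (λ i → Big? i (∞ e) ×-dec (Big? i (∞ e′) ×-dec Big? i ⟨ j , c ⟩)) j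
                                  (tt , tt , refl) λ { i (_ , _ , refl) → refl })
            (cong₂ _+_ (∑-zero λ d → ∑#-none (tri₃? d r (∞ e) (∞ e′) ⟨ j , c ⟩)
                                       λ i a (e≡d , e′≡d , _) → e≢e′ (trans e≡d (sym e′≡d)))
            (cong₂ _+_ (transversal₃-∞ r e (∞ e′) ⟨ j , c ⟩) (wedges₃-∞ r e (∞ e′) ⟨ j , c ⟩))))

    cover-∞-row : ∀ e j {c c′} → c ≢ c′ → Cover (∞ e) ⟨ j , c ⟩ ⟨ j , c′ ⟩
    cover-∞-row e j {c} {c′} c≢c′ = in-big j (tt , refl , refl) λ r →
      trans (count-through₃ r (∞ e) ⟨ j , c ⟩ ⟨ j , c′ ⟩)
            (cong₂ _+_ (#-unique (λ i → Big? i (∞ e) ×-dec (Big? i ⟨ j , c ⟩ ×-dec Big? i ⟨ j , c′ ⟩)) j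
                                  (tt , refl , refl) λ { i (_ , refl , _) → refl })
            (cong₂ _+_ (∑-zero λ d → ∑#-none (tri₃? d r (∞ e) ⟨ j , c ⟩ ⟨ j , c′ ⟩)
                                       λ i a (_ , m₁ , m₂) → c≢c′ (coincide (slots-same-row m₁ m₂)))
            (cong₂ _+_ (transversal₃-∞ r e ⟨ j , c ⟩ ⟨ j , c′ ⟩) (wedges₃-∞ r e ⟨ j , c ⟩ ⟨ j , c′ ⟩))))

    private
      no-wedge-in-row : ∀ {d r i y y′ j c c′ c″} → c ≢ c′ → c ≢ c″ → c′ ≢ c″ → Wedge d r i y y′ ⟨ j , c ⟩ →
                        Wedge d r i y y′ ⟨ j , c′ ⟩ → Wedge d r i y y′ ⟨ j , c″ ⟩ → ⊥
      no-wedge-in-row c≢c′ c≢c″ c′≢c″ m₁ m₂ m₃ with slots-same-row m₁ m₂ | slots-same-row m₁ m₃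
      ... | inj₂ (_ , c≡ , c′≡) | _                   = c≢c′ (trans c≡ (sym c′≡))
      ... | inj₁ _              | inj₂ (_ , c≡ , c″≡) = c≢c″ (trans c≡ (sym c″≡))
      ... | inj₁ (_ , c∈ , c′∈) | inj₁ (_ , _ , c″∈)  = pigeonhole₂ c∈ c′∈ c″∈ c≢c′ c≢c″ c′≢c″

    cover-row : ∀ j {c c′ c″} → c ≢ c′ → c ≢ c″ → c′ ≢ c″ → Cover ⟨ j , c ⟩ ⟨ j , c′ ⟩ ⟨ j , c″ ⟩
    cover-row j {c} {c′} {c″} c≢c′ c≢c″ c′≢c″ = in-big j (refl , refl , refl) λ r →
      trans (count-through₃ r ⟨ j , c ⟩ ⟨ j , c′ ⟩ ⟨ j , c″ ⟩)
            (cong₂ _+_ (#-unique (λ i → Big? i ⟨ j , c ⟩ ×-dec (Big? i ⟨ j , c′ ⟩ ×-dec Big? i ⟨ j , c″ ⟩)) j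
                                  (refl , refl , refl) λ { i (refl , _) → refl })
            (cong₂ _+_ (∑-zero λ d → ∑#-none (tri₃? d r ⟨ j , c ⟩ ⟨ j , c′ ⟩ ⟨ j , c″ ⟩)
                                       λ i a (m₁ , m₂ , _) → c≢c′ (coincide (slots-same-row m₁ m₂)))
            (cong₂ _+_ (∑#-none (transversal₃? r ⟨ j , c ⟩ ⟨ j , c′ ⟩ ⟨ j , c″ ⟩)
                                λ a b (c≡ , c′≡ , _) → c≢c′ (trans c≡ (sym c′≡)))
                       (∑-zero λ d → ∑-zero λ i → ∑#-none (wedge₃? d r ⟨ j , c ⟩ ⟨ j , c′ ⟩ ⟨ j , c″ ⟩ i)
                                       λ y y′ (_ , m₁ , m₂ , m₃) → no-wedge-in-row c≢c′ c≢c″ c′≢c″ m₁ m₂ m₃))))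

    cover-∞-step : ∀ e j c c′ → Cover (∞ e) ⟨ j , c ⟩ ⟨ shift e j , c′ ⟩
    cover-∞-step e j c c′ =
      in-small (λ i (_ , j≡i , sj≡i) → shift-≢ e j (trans sj≡i (sym j≡i)))
               (trans (sum-cong-≗ per-design) (translation-unique (c ⊕ c) c′))
      where
        p q s : Pt
        p = ∞ e
        q = ⟨ j , c ⟩
        s = ⟨ shift e j , c′ ⟩
        tris : ∀ r → #tris₃ r p q s ≡ ⟦ does (c′ ≟ c ⊕ c ⊕ r) ⟧
        tris r = trans (∑-support e λ d d≢e → ∑#-none (tri₃? d r p q s) λ i a (e≡d , _) → d≢e (sym e≡d))
                       (trans (∑#-cong (tri₃? e r p q s) (tri₂? e r q s) λ i a → mk⇔ proj₂ (refl ,_))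
                              (tri-step e r j c c′))
        per-design : ∀ r → count (Through₃ p q s) (design r) ≡ ⟦ does (c′ ≟ c ⊕ c ⊕ r) ⟧
        per-design r = trans (count-through₃ r p q s)
          (trans (cong₂ _+_ (#-none (λ i → Big? i p ×-dec (Big? i q ×-dec Big? i s))
                                    λ i (_ , j≡i , sj≡i) → shift-≢ e j (trans sj≡i (sym j≡i)))
                            (cong₂ _+_ (tris r) (cong₂ _+_ (transversal₃-∞ r e q s) (wedges₃-∞ r e q s))))
                 (+-identityʳ _))

    wedge₃-other-direction : ∀ d d′ r j {c c′} e → c ≢ c′ → d′ ≢ d → #wedge₃ d′ r ⟨ j , c ⟩ ⟨ j , c′ ⟩ ⟨ shift d j , e ⟩ ≡ 0
    wedge₃-other-direction d d′ r j {c} {c′} e c≢c′ d′≢d =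
      ∑-zero λ i → ∑#-none (wedge₃? d′ r ⟨ j , c ⟩ ⟨ j , c′ ⟩ ⟨ shift d j , e ⟩ i) λ y y′ (_ , m₁ , m₂ , m₃) →
        case slots-same-row m₁ m₂ of λ where
          (inj₂ (_ , c≡ , c′≡)) → c≢c′ (trans c≡ (sym c′≡))
          (inj₁ (refl , _)) → case m₃ of λ where
            (inj₁ (sj≡j , _))   → shift-≢ d j sj≡j
            (inj₂ (sj≡s′j , _)) → d′≢d (sym (shift-direction-injective j sj≡s′j))

    wedge₃-row-step : ∀ d r j {c c′} e → c ≢ c′ →
                      #wedge₃ d r ⟨ j , c ⟩ ⟨ j , c′ ⟩ ⟨ shift d j , e ⟩ ≡ ⟦ does (e ≟ c ⊕ c′ ⊕ r) ⟧
    wedge₃-row-step d r j {c} {c′} e c≢c′ = begin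
      #wedge₃ d r p q s
        ≡⟨ ∑-support j (λ i i≢j → ∑#-none (wedge₃? d r p q s i) λ y y′ (_ , m₁ , _ , m₃) →
                                    i≢j (sym (proj₁ (slots-step m₁ m₃)))) ⟩
      sum (λ y → # wedge₃? d r p q s j y)
        ≡⟨ ∑#-cong (wedge₃? d r p q s j) (λ y y′ → (y <? y′ ×-dec unorderedPair? c c′ y y′) ×-dec (e ≟ c ⊕ c′ ⊕ r))
                   (λ y y′ → mk⇔ (λ (y<y′ , m₁ , m₂ , m₃) → (y<y′ , same-row-pair c≢c′ m₁ m₂) ,
                                    trans (proj₂ (proj₂ (slots-step m₁ m₃))) (pair-sum (same-row-pair c≢c′ m₁ m₂)))
                                  (λ ((y<y′ , u) , e≡) → y<y′ , proj₁ (same-row-members u) , proj₂ (same-row-members u) ,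
                                                         inj₂ (refl , trans e≡ (sym (pair-sum u))))) ⟩
      sum (λ y → # λ y′ → (y <? y′ ×-dec unorderedPair? c c′ y y′) ×-dec (e ≟ c ⊕ c′ ⊕ r))
        ≡⟨ ∑#-×-const (λ y y′ → y <? y′ ×-dec unorderedPair? c c′ y y′) (e ≟ c ⊕ c′ ⊕ r)
                      (trans (#-unordered-pair c c′) (cong (⟦_⟧ ∘ not) (dec-false (c ≟ c′) c≢c′))) ⟩
      ⟦ does (e ≟ c ⊕ c′ ⊕ r) ⟧ ∎
      where
        open ≡-Reasoning
        p q s : Pt
        p = ⟨ j , c ⟩
        q = ⟨ j , c′ ⟩
        s = ⟨ shift d j , e ⟩
        pair-sum : ∀ {y y′} → UnorderedPair c c′ y y′ → y ⊕ y′ ⊕ r ≡ c ⊕ c′ ⊕ r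
        pair-sum (inj₁ (refl , refl)) = refl
        pair-sum (inj₂ (refl , refl)) = cong (_⊕ r) (comm c′ c)

    cover-row-step : ∀ d j {c c′} e → c ≢ c′ → Cover ⟨ j , c ⟩ ⟨ j , c′ ⟩ ⟨ shift d j , e ⟩
    cover-row-step d j {c} {c′} e c≢c′ =
      in-small (λ i (j≡i , _ , sj≡i) → shift-≢ d j (trans sj≡i (sym j≡i)))
               (trans (sum-cong-≗ per-design) (translation-unique (c ⊕ c′) e))
      where
        p q s : Pt
        p = ⟨ j , c ⟩
        q = ⟨ j , c′ ⟩
        s = ⟨ shift d j , e ⟩
        per-design : ∀ r → count (Through₃ p q s) (design r) ≡ ⟦ does (e ≟ c ⊕ c′ ⊕ r) ⟧
        per-design r = trans (count-through₃ r p q s)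
          (cong₂ _+_ (#-none (λ i → Big? i p ×-dec (Big? i q ×-dec Big? i s))
                             λ i (j≡i , _ , sj≡i) → shift-≢ d j (trans sj≡i (sym j≡i)))
          (cong₂ _+_ (∑-zero λ d′ → ∑#-none (tri₃? d′ r p q s) λ i a (m₁ , m₂ , _) → c≢c′ (coincide (slots-same-row m₁ m₂)))
          (cong₂ _+_ (∑#-none (transversal₃? r p q s) λ a b (c≡ , c′≡ , _) → c≢c′ (trans c≡ (sym c′≡)))
                     (trans (∑-support d λ d′ → wedge₃-other-direction d d′ r j e c≢c′) (wedge₃-row-step d r j e c≢c′)))))

    private
      row-of : ∀ {k i u : Row} {A B : Set} → (k ≡ i × A) ⊎ (k ≡ u × B) → k ≡ i ⊎ k ≡ u
      row-of = Sum.map proj₁ proj₁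

    cover-rows : ∀ a b e → Cover ⟨ 0F , a ⟩ ⟨ 1F , b ⟩ ⟨ 2F , e ⟩
    cover-rows a b e =
      in-small (λ { i (refl , () , _) })
               (trans (sum-cong-≗ per-design) (subtraction-unique (a ⊕ b) e))
      where
        p q s : Pt
        p = ⟨ 0F , a ⟩
        q = ⟨ 1F , b ⟩
        s = ⟨ 2F , e ⟩
        three-rows : ∀ {i u : Row} → 0F ≡ i ⊎ 0F ≡ u → 1F ≡ i ⊎ 1F ≡ u → 2F ≡ i ⊎ 2F ≡ u → ⊥
        three-rows r₀ r₁ r₂ = pigeonhole₂ r₀ r₁ r₂ (λ ()) (λ ()) (λ ())
        per-design : ∀ r → count (Through₃ p q s) (design r) ≡ ⟦ does (e ≟ r ⊖ (a ⊕ b)) ⟧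
        per-design r = trans (count-through₃ r p q s)
          (trans (cong₂ _+_ (#-none (λ i → Big? i p ×-dec (Big? i q ×-dec Big? i s)) λ { i (refl , () , _) })
                 (cong₂ _+_ (∑-zero λ d → ∑#-none (tri₃? d r p q s) λ i a (m₀ , m₁ , m₂) →
                                           three-rows (row-of m₀) (row-of m₁) (row-of m₂))
                 (cong₂ _+_ (∑#-solve (transversal₃? r p q s) a b (λ { a′ b′ (refl , refl , _) → refl , refl })
                                      (mk⇔ (proj₂ ∘ proj₂) λ e≡ → refl , refl , e≡) (e ≟ r ⊖ (a ⊕ b)))
                            (∑-zero λ d → ∑-zero λ i → ∑#-none (wedge₃? d r p q s i) λ y y′ (_ , m₀ , m₁ , m₂) →
                                           three-rows (row-of m₀) (row-of m₁) (row-of m₂)))))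
                 (+-identityʳ _))

    private
      same-row-distinct : ∀ {j c c′} → ⟨ j , c ⟩ ≢ ⟨ j , c′ ⟩ → c ≢ c′
      same-row-distinct {j} p≢q c≡c′ = p≢q (cong (λ x → ⟨ j , x ⟩) c≡c′)

      ∞-distinct : ∀ {e e′} → ∞ e ≢ ∞ e′ → e ≢ e′
      ∞-distinct p≢q e≡e′ = p≢q (cong ∞ e≡e′)

    private
      cover-∞-pts : ∀ e j c j′ c′ → ⟨ j , c ⟩ ≢ ⟨ j′ , c′ ⟩ → Cover (∞ e) ⟨ j , c ⟩ ⟨ j′ , c′ ⟩
      cover-∞-pts e j c j′ c′ q≢s with j ≟ j′
      ... | yes refl = cover-∞-row e j (same-row-distinct q≢s)
      ... | no j≢j′ with adjacent-rows j≢j′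
      ... | d , refl = by-direction d e
        where
          by-direction : ∀ d e → Cover (∞ e) ⟨ j , c ⟩ ⟨ shift d j , c′ ⟩
          by-direction 0F 0F = cover-∞-step 0F j c c′
          by-direction 1F 1F = cover-∞-step 1F j c c′
          by-direction 0F 1F = cover-swap₂₃ (subst (λ k → Cover (∞ 1F) ⟨ shift 0F j , c′ ⟩ ⟨ k , c ⟩)
                                                   (shift-inverse 0F j) (cover-∞-step 1F (shift 0F j) c′ c))
          by-direction 1F 0F = cover-swap₂₃ (subst (λ k → Cover (∞ 0F) ⟨ shift 1F j , c′ ⟩ ⟨ k , c ⟩)
                                                   (shift-inverse 1F j) (cover-∞-step 0F (shift 1F j) c′ c))

      cover-distinct-rows : ∀ {j j′ j″} c c′ c″ → j ≢ j′ → j ≢ j″ → j′ ≢ j″ → Cover ⟨ j , c ⟩ ⟨ j′ , c′ ⟩ ⟨ j″ , c″ ⟩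
      cover-distinct-rows {j} c c′ c″ j≢j′ j≢j″ j′≢j″ with adjacent-rows j≢j′ | adjacent-rows j≢j″
      ... | d , refl | e , refl = by-directions d e j j′≢j″
        where
          by-directions : ∀ d e j → shift d j ≢ shift e j → Cover ⟨ j , c ⟩ ⟨ shift d j , c′ ⟩ ⟨ shift e j , c″ ⟩
          by-directions 0F 0F _  ne = ⊥-elim (ne refl)
          by-directions 1F 1F _  ne = ⊥-elim (ne refl)
          by-directions 0F 1F 0F _  = cover-rows c c′ c″
          by-directions 0F 1F 1F _  = cover-swap₂₃ (cover-swap₁₂ (cover-rows c″ c c′))
          by-directions 0F 1F 2F _  = cover-swap₁₂ (cover-swap₂₃ (cover-rows c′ c″ c))
          by-directions 1F 0F 0F _  = cover-swap₂₃ (cover-rows c c″ c′)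
          by-directions 1F 0F 1F _  = cover-swap₁₂ (cover-rows c′ c c″)
          by-directions 1F 0F 2F _  = cover-swap₂₃ (cover-swap₁₂ (cover-swap₂₃ (cover-rows c″ c′ c)))

      cover-pts : ∀ j c j′ c′ j″ c″ → ⟨ j , c ⟩ ≢ ⟨ j′ , c′ ⟩ → ⟨ j , c ⟩ ≢ ⟨ j″ , c″ ⟩ → ⟨ j′ , c′ ⟩ ≢ ⟨ j″ , c″ ⟩ →
                  Cover ⟨ j , c ⟩ ⟨ j′ , c′ ⟩ ⟨ j″ , c″ ⟩
      cover-pts j c j′ c′ j″ c″ p≢q p≢s q≢s with j ≟ j′ | j ≟ j″ | j′ ≟ j″
      ... | yes refl | yes refl | _ = cover-row j (same-row-distinct p≢q) (same-row-distinct p≢s) (same-row-distinct q≢s)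
      ... | yes refl | no j≢j″ | _ with adjacent-rows j≢j″
      ...   | d , refl = cover-row-step d j c″ (same-row-distinct p≢q)
      cover-pts j c j′ c′ j″ c″ p≢q p≢s q≢s | no j≢j′ | yes refl | _ with adjacent-rows j≢j′
      ...   | d , refl = cover-swap₂₃ (cover-row-step d j c′ (same-row-distinct p≢s))
      cover-pts j c j′ c′ j″ c″ p≢q p≢s q≢s | no j≢j′ | no j≢j″ | yes refl with adjacent-rows (j≢j′ ∘ sym)
      ...   | d , refl = cover-swap₁₂ (cover-swap₂₃ (cover-row-step d j′ c (same-row-distinct q≢s)))
      cover-pts j c j′ c′ j″ c″ p≢q p≢s q≢s | no j≢j′ | no j≢j″ | no j′≢j″ =
        cover-distinct-rows c c′ c″ j≢j′ j≢j″ j′≢j″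

    cover : ∀ {p q s} → p ≢ q → p ≢ s → q ≢ s → Cover p q s
    cover {∞ e} {∞ e′} {∞ e″} p≢q p≢s q≢s =
      ⊥-elim (pigeonhole₂ (two e) (two e′) (two e″) (∞-distinct p≢q) (∞-distinct p≢s) (∞-distinct q≢s))
      where
        two : ∀ (x : Fin 2) → x ≡ 0F ⊎ x ≡ 1F
        two 0F = inj₁ refl
        two 1F = inj₂ refl
    cover {∞ e} {∞ e′} {⟨ j , c ⟩} p≢q _ _ = cover-∞∞ (∞-distinct p≢q) j c
    cover {∞ e} {⟨ j , c ⟩} {∞ e′} _ p≢s _ = cover-swap₂₃ (cover-∞∞ (∞-distinct p≢s) j c)
    cover {⟨ j , c ⟩} {∞ e} {∞ e′} _ _ q≢s = cover-swap₁₂ (cover-swap₂₃ (cover-∞∞ (∞-distinct q≢s) j c))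
    cover {∞ e} {⟨ j , c ⟩} {⟨ j′ , c′ ⟩} _ _ q≢s = cover-∞-pts e j c j′ c′ q≢s
    cover {⟨ j , c ⟩} {∞ e} {⟨ j′ , c′ ⟩} _ p≢s _ = cover-swap₁₂ (cover-∞-pts e j c j′ c′ p≢s)
    cover {⟨ j , c ⟩} {⟨ j′ , c′ ⟩} {∞ e} p≢q _ _ = cover-swap₂₃ (cover-swap₁₂ (cover-∞-pts e j c j′ c′ p≢q))
    cover {⟨ j , c ⟩} {⟨ j′ , c′ ⟩} {⟨ j″ , c″ ⟩} = cover-pts j c j′ c′ j″ c″

    infinities : Blk → ℕ
    infinities χ = ⟦ χ (∞ 0F) ⟧ + ⟦ χ (∞ 1F) ⟧

    size : Blk → ℕ
    size χ = sum (λ j → sum λ c → ⟦ χ ⟨ j , c ⟩ ⟧) + infinities χ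

    Distinct₃ : Pt → Pt → Pt → Set
    Distinct₃ p q s = p ≢ q × p ≢ s × q ≢ s

    record Triangle (χ : Blk) : Set where
      field
        size≡3      : size χ ≡ 3
        infinities≤1 : infinities χ ≡ 0 ⊎ infinities χ ≡ 1
        corners     : ∃[ p ] ∃[ q ] ∃[ s ] Distinct₃ p q s × Through₃ p q s χ ≡ true

    private
      ∞≢pt : ∀ {e j c} → ∞ e ≢ ⟨ j , c ⟩
      ∞≢pt ()

      rows-differ : ∀ {j j′ c c′} → j ≢ j′ → ⟨ j , c ⟩ ≢ ⟨ j′ , c′ ⟩
      rows-differ j≢j′ refl = j≢j′ refl

      values-differ : ∀ {j c c′} → c ≢ c′ → ⟨ j , c ⟩ ≢ ⟨ j , c′ ⟩
      values-differ c≢c′ refl = c≢c′ refl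

    tri-triangle : ∀ d r i a → Triangle ⌊ Tri? d r i a ⌋
    tri-triangle d r i a = record
      { size≡3       = cong₂ _+_ finite (infinities-tri d)
      ; infinities≤1 = inj₂ (infinities-tri d)
      ; corners      = ∞ d , ⟨ i , a ⟩ , ⟨ shift d i , a ⊕ a ⊕ r ⟩ , (∞≢pt , ∞≢pt , rows-differ (shift-≢ d i ∘ sym)) ,
                       dec-true (Tri? d r i a (∞ d) ×-dec (Tri? d r i a ⟨ i , a ⟩ ×-dec Tri? d r i a ⟨ shift d i , a ⊕ a ⊕ r ⟩))
                                (refl , inj₁ (refl , refl) , inj₂ (refl , refl)) }
      where
        finite : sum (λ j → # λ c → Tri? d r i a ⟨ j , c ⟩) ≡ 2
        finite = trans (∑#-⊎ (λ j c → j ≟ i ×-dec c ≟ a) (λ j c → j ≟ shift d i ×-dec c ≟ a ⊕ a ⊕ r)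
                             λ { j c (refl , _) (j≡ , _) → shift-≢ d j (sym j≡) })
                       (cong₂ _+_ (∑#-unique (λ j c → j ≟ i ×-dec c ≟ a) i a (refl , refl) λ { j c (refl , refl) → refl , refl })
                                  (∑#-unique (λ j c → j ≟ shift d i ×-dec c ≟ a ⊕ a ⊕ r) (shift d i) (a ⊕ a ⊕ r) (refl , refl)
                                             λ { j c (refl , refl) → refl , refl }))
        infinities-tri : ∀ d → infinities ⌊ Tri? d r i a ⌋ ≡ 1
        infinities-tri 0F = refl
        infinities-tri 1F = refl

    transversal-triangle : ∀ r a b → Triangle ⌊ Transversal? r a b ⌋
    transversal-triangle r a b = record
      { size≡3       = trans (+-identityʳ _) (cong₂ _+_ (one 0F) (cong₂ _+_ (one 1F) (cong₂ _+_ (one 2F) refl)))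
      ; infinities≤1 = inj₁ refl
      ; corners      = ⟨ 0F , a ⟩ , ⟨ 1F , b ⟩ , ⟨ 2F , r ⊖ (a ⊕ b) ⟩ , (rows-differ (λ ()) , rows-differ (λ ()) , rows-differ (λ ())) ,
                       dec-true (Transversal? r a b ⟨ 0F , a ⟩ ×-dec (Transversal? r a b ⟨ 1F , b ⟩ ×-dec Transversal? r a b ⟨ 2F , r ⊖ (a ⊕ b) ⟩))
                                (refl , refl , refl) }
      where
        one : ∀ j → # (λ c → c ≟ transversal-coord r a b j) ≡ 1
        one j = #-unique (λ c → c ≟ transversal-coord r a b j) (transversal-coord r a b j) refl λ c c≡ → c≡

    wedge-triangle : ∀ d r i {y y′} → y < y′ → Triangle ⌊ Wedge? d r i y y′ ⌋
    wedge-triangle d r i {y} {y′} y<y′ = record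
      { size≡3       = trans (+-identityʳ _) finite
      ; infinities≤1 = inj₁ refl
      ; corners      = ⟨ i , y ⟩ , ⟨ i , y′ ⟩ , ⟨ shift d i , y ⊕ y′ ⊕ r ⟩ ,
                       (values-differ (<⇒≢ y<y′) , rows-differ (shift-≢ d i ∘ sym) , rows-differ (shift-≢ d i ∘ sym)) ,
                       dec-true (Wedge? d r i y y′ ⟨ i , y ⟩ ×-dec (Wedge? d r i y y′ ⟨ i , y′ ⟩ ×-dec Wedge? d r i y y′ ⟨ shift d i , y ⊕ y′ ⊕ r ⟩))
                                (inj₁ (refl , inj₁ refl) , inj₁ (refl , inj₂ refl) , inj₂ (refl , refl)) }
      where
        row-part : sum (λ j → # λ c → j ≟ i ×-dec (c ≟ y ⊎-dec c ≟ y′)) ≡ 2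
        row-part = trans (∑-support i λ j j≢i → #-none (λ c → j ≟ i ×-dec (c ≟ y ⊎-dec c ≟ y′)) λ c → j≢i ∘ proj₁)
                   (trans (#-cong (λ c → i ≟ i ×-dec (c ≟ y ⊎-dec c ≟ y′)) (λ c → c ≟ y ⊎-dec c ≟ y′) λ c → mk⇔ proj₂ (refl ,_))
                   (trans (#-⊎ (_≟ y) (_≟ y′) λ { c refl c≡y′ → <⇒≢ y<y′ c≡y′ })
                          (cong₂ _+_ (#-unique (_≟ y) y refl λ _ → id) (#-unique (_≟ y′) y′ refl λ _ → id))))
        finite : sum (λ j → # λ c → Wedge? d r i y y′ ⟨ j , c ⟩) ≡ 3
        finite = trans (∑#-⊎ (λ j c → j ≟ i ×-dec (c ≟ y ⊎-dec c ≟ y′)) (λ j c → j ≟ shift d i ×-dec c ≟ y ⊕ y′ ⊕ r)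
                             λ { j c (refl , _) (j≡ , _) → shift-≢ d j (sym j≡) })
                       (cong₂ _+_ row-part (∑#-unique (λ j c → j ≟ shift d i ×-dec c ≟ y ⊕ y′ ⊕ r) (shift d i) (y ⊕ y′ ⊕ r)
                                                      (refl , refl) λ { j c (refl , refl) → refl , refl }))

    big-size : ∀ i → size ⌊ Big? i ⌋ ≡ n + 2
    big-size i = cong (_+ 2) (begin
      sum (λ j → sum λ (c : Z) → ⟦ does (j ≟ i) ⟧)
        ≡⟨ ∑-support i (λ j j≢i → ∑-zero {f = λ (c : Z) → ⟦ does (j ≟ i) ⟧} λ c → cong ⟦_⟧ (dec-false (j ≟ i) j≢i)) ⟩
      sum (λ (c : Z) → ⟦ does (i ≟ i) ⟧)
        ≡⟨ sum-cong-≗ {x = λ (c : Z) → ⟦ does (i ≟ i) ⟧} (λ c → cong ⟦_⟧ (dec-true (i ≟ i) refl)) ⟩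
      sum (λ (c : Z) → 1)
        ≡⟨ ∑-const-1 n ⟩
      n ∎)
      where open ≡-Reasoning

    big-corners : ∀ i → ∃[ p ] ∃[ q ] ∃[ s ] Distinct₃ p q s × Through₃ p q s ⌊ Big? i ⌋ ≡ true
    big-corners i = ∞ 0F , ∞ 1F , ⟨ i , 0# ⟩ , ((λ ()) , ∞≢pt , ∞≢pt) , dec-true (i ≟ i) refl

    triangles : ∀ r → All Triangle (small-blocks r)
    triangles r = ++⁺ (concat⁺ (tabulate⁺ λ d → concat⁺ (tabulate⁺ λ i → tabulate⁺ λ a → tri-triangle d r i a)))
                  (++⁺ (concat⁺ (tabulate⁺ λ a → tabulate⁺ λ b → transversal-triangle r a b))
                       (concat⁺ (tabulate⁺ λ d → concat⁺ (tabulate⁺ λ i → concat⁺ (tabulate⁺ λ y → concat⁺ (tabulate⁺ λ y′ →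
                         wedge-if-triangle d i y y′))))))
      where
        wedge-if-triangle : ∀ d i y y′ → All Triangle (wedge-if r d i y y′)
        wedge-if-triangle d i y y′ with does (y <? y′) in lt
        ... | true  = wedge-triangle d r i (witness (y <? y′) (Equivalence.from T-≡ lt)) ∷ []
        ... | false = []

module Relabel where

  open import Defs
  open Counting
  open TripleCovers
  open Construction
  open import Data.Nat using (ℕ; zero; suc; _+_; _*_; _∸_; _≤_; s≤s; z≤n)
  open import Data.Nat.Properties using (+-identityʳ; m+n∸n≡m)
  open import Data.Bool using (Bool; true; false; _∧_)
  open import Data.Fin using (Fin; zero; suc; _↑ˡ_; _↑ʳ_; splitAt; join; combine; remQuot)
  open import Data.Fin.Patterns using (0F; 1F)
  open import Data.Fin.Properties using (splitAt-↑ˡ; splitAt-↑ʳ; join-splitAt; remQuot-combine; combine-remQuot)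
  open import Data.Fin.Subset using (Subset; ∣_∣)
  open import Data.Vec using (lookup)
  import Data.Vec as Vec
  open import Data.Vec.Properties using (lookup∘tabulate)
  open import Data.List using (List; concat; tabulate; map)
  open import Data.List.Relation.Unary.All using (All)
  import Data.List.Relation.Unary.All as All
  open import Data.List.Relation.Unary.All.Properties using (tabulate⁺; map⁺)
  open import Data.Product using (_×_; _,_; proj₂; ∃-syntax; uncurry)
  open import Data.Sum using (_⊎_; inj₁; inj₂; [_,_]′)
  open import Function using (_∘_; Equivalence)
  open import Data.Bool.Properties using (T-≡)
  open import Data.Empty using (⊥-elim)
  open import Relation.Nullary using (¬_; _×-dec_)
  open import Relation.Nullary.Decidable using (dec-true)
  open import Data.List.Membership.Propositional using (_∈_)
  open import Data.List.Membership.Propositional.Properties using (∈-concat⁻′; ∈-concat⁺′; ∈-map⁻; ∈-map⁺; ∈-++⁻; ∈-++⁺ˡ)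
  import Data.List.Relation.Unary.Any.Properties as Any
  open import Relation.Binary.PropositionalEquality

  module _ {n} (G : HalvingGroup n) where

    open HalvingGroup G
    open Design G

    v : ℕ
    v = 3 * n + 2

    fromFin : Fin v → Pt
    fromFin x = [ uncurry ⟨_,_⟩ ∘ remQuot n , ∞ ]′ (splitAt (3 * n) x)

    toFin : Pt → Fin v
    toFin ⟨ j , c ⟩ = combine j c ↑ˡ 2
    toFin (∞ e)     = (3 * n) ↑ʳ e

    fromFin-toFin : ∀ p → fromFin (toFin p) ≡ p
    fromFin-toFin ⟨ j , c ⟩ =
      trans (cong [ uncurry ⟨_,_⟩ ∘ remQuot n , ∞ ]′ (splitAt-↑ˡ (3 * n) (combine j c) 2))
            (cong (uncurry ⟨_,_⟩) (remQuot-combine j c))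
    fromFin-toFin (∞ e)     rewrite splitAt-↑ʳ (3 * n) 2 e = refl

    toFin-fromFin : ∀ x → toFin (fromFin x) ≡ x
    toFin-fromFin x with splitAt (3 * n) x in eq
    ... | inj₁ y = trans (cong (_↑ˡ 2) (combine-remQuot n y))
                         (trans (cong (join (3 * n) 2) (sym eq)) (join-splitAt (3 * n) 2 x))
    ... | inj₂ e = trans (cong (join (3 * n) 2) (sym eq)) (join-splitAt (3 * n) 2 x)

    fromFin-injective : ∀ {x y} → fromFin x ≡ fromFin y → x ≡ y
    fromFin-injective {x} {y} e = trans (sym (toFin-fromFin x)) (trans (cong toFin e) (toFin-fromFin y))

    toSub : Blk → Subset v
    toSub χ = Vec.tabulate (χ ∘ fromFin)

    lookup-toSub : ∀ χ p → lookup (toSub χ) (toFin p) ≡ χ p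
    lookup-toSub χ p = trans (lookup∘tabulate (χ ∘ fromFin) (toFin p)) (cong χ (fromFin-toFin p))

    ∣tabulate∣ : ∀ {m} (f : Fin m → Bool) → ∣ Vec.tabulate f ∣ ≡ sum (⟦_⟧ ∘ f)
    ∣tabulate∣ {zero}  f = refl
    ∣tabulate∣ {suc m} f with f zero
    ... | true  = cong suc (∣tabulate∣ (f ∘ suc))
    ... | false = ∣tabulate∣ (f ∘ suc)

    ∑-fromFin : (g : Pt → ℕ) → sum (g ∘ fromFin) ≡ sum (λ j → sum λ c → g ⟨ j , c ⟩) + (g (∞ 0F) + (g (∞ 1F) + 0))
    ∑-fromFin g = trans (∑-splitAt (3 * n) {2} (g ∘ fromFin)) (cong₂ _+_ rows infinite)
      where
        rows : sum (λ y → g (fromFin (y ↑ˡ 2))) ≡ sum λ j → sum λ c → g ⟨ j , c ⟩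
        rows = trans (∑-combine 3 {n} λ y → g (fromFin (y ↑ˡ 2)))
                     (sum-cong-≗ {x = λ (j : Row) → sum λ (c : Z) → g (fromFin (combine j c ↑ˡ 2))} λ j →
                      sum-cong-≗ {x = λ (c : Z) → g (fromFin (combine j c ↑ˡ 2))} λ c → cong g (fromFin-toFin ⟨ j , c ⟩))
        infinite : sum (λ e → g (fromFin ((3 * n) ↑ʳ e))) ≡ g (∞ 0F) + (g (∞ 1F) + 0)
        infinite = cong₂ _+_ (cong g (fromFin-toFin (∞ 0F))) (cong₂ _+_ (cong g (fromFin-toFin (∞ 1F))) refl)

    ∣toSub∣ : ∀ χ → ∣ toSub χ ∣ ≡ size χ
    ∣toSub∣ χ =
      trans (∣tabulate∣ (χ ∘ fromFin)) (trans (∑-fromFin (⟦_⟧ ∘ χ))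
            (cong (λ t → sum (λ j → sum λ c → ⟦ χ ⟨ j , c ⟩ ⟧) + (⟦ χ (∞ 0F) ⟧ + t)) (+-identityʳ ⟦ χ (∞ 1F) ⟧)))

    i₁ i₂ : Fin v
    i₁ = toFin (∞ 0F)
    i₂ = toFin (∞ 1F)

    infCount-toSub : ∀ χ → infCount i₁ i₂ (toSub χ) ≡ infinities χ
    infCount-toSub χ = cong₂ _+_ (cong ⟦_⟧ (lookup-toSub χ (∞ 0F))) (cong ⟦_⟧ (lookup-toSub χ (∞ 1F)))

    Ds : List (List (Subset v))
    Ds = tabulate λ r → map toSub (design r)

    count-toSub : ∀ (P : Subset v → Bool) (Q : Blk → Bool) → (∀ χ → P (toSub χ) ≡ Q χ) →
                  ∀ r → count P (map toSub (design r)) ≡ count Q (design r)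
    count-toSub P Q P≡Q r = trans (count-map P toSub (design r)) (count-cong-∈ (design r) λ {χ} _ → P≡Q χ)

    ∈-Ds⁻ : ∀ {B} → B ∈ concat Ds → ∃[ r ] ∃[ χ ] χ ∈ design r × B ≡ toSub χ
    ∈-Ds⁻ B∈ with ∈-concat⁻′ Ds B∈
    ... | xs , B∈xs , xs∈Ds with Any.tabulate⁻ xs∈Ds
    ... | r , refl with ∈-map⁻ toSub B∈xs
    ... | χ , χ∈ , refl = r , χ , χ∈ , refl

    ∈-Ds⁺ : ∀ {χ} r → χ ∈ design r → toSub χ ∈ concat Ds
    ∈-Ds⁺ r χ∈ = ∈-concat⁺′ (∈-map⁺ toSub χ∈) (Any.tabulate⁺ r refl)

    data Shape (χ : Blk) : Set where
      big      : ∀ i → χ ≡ ⌊ Big? i ⌋ → Shape χ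
      triangle : Triangle χ → Shape χ

    shape : ∀ {r χ} → χ ∈ design r → Shape χ
    shape {r} χ∈ with ∈-++⁻ bigs χ∈
    ... | inj₁ χ∈bigs  = let i , χ≡ = Any.tabulate⁻ {f = λ i → ⌊ Big? i ⌋} χ∈bigs in big i χ≡
    ... | inj₂ χ∈small = triangle (All.lookup (triangles r) χ∈small)

    contains₃-toSub : ∀ x y z χ → Contains₃ x y z (toSub χ) ≡ Through₃ (fromFin x) (fromFin y) (fromFin z) χ
    contains₃-toSub x y z χ =
      cong₂ _∧_ (lookup∘tabulate (χ ∘ fromFin) x)
                (cong₂ _∧_ (lookup∘tabulate (χ ∘ fromFin) y) (lookup∘tabulate (χ ∘ fromFin) z))

    count-Ds : ∀ x y z → count (Contains₃ x y z) (concat Ds) ≡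
               sum λ r → count (Through₃ (fromFin x) (fromFin y) (fromFin z)) (design r)
    count-Ds x y z = trans (count-concat-tabulate (Contains₃ x y z) (λ r → map toSub (design r)))
                           (sum-cong-≗ λ r → count-toSub (Contains₃ x y z) (Through₃ (fromFin x) (fromFin y) (fromFin z))
                                                         (contains₃-toSub x y z) r)

    module _ {x y z : Fin v} where

      private
        p q s : Pt
        p = fromFin x
        q = fromFin y
        s = fromFin z

      big-triple-cover : ∀ i → InBig i p q s → (∀ r → count (Through₃ p q s) (design r) ≡ 1) →
                         TripleCover (concat Ds) x y z
      big-triple-cover i inBig once = record
        { block   = toSub ⌊ Big? i ⌋
        ; ∈L      = ∈-Ds⁺ 0# big∈
        ; through = big-through
        ; unique  = unique
        ; count≡  = begin
            count (Contains₃ x y z) (concat Ds) ≡⟨ count-Ds x y z ⟩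
            sum (λ r → count (Through₃ p q s) (design r)) ≡⟨ sum-cong-≗ once ⟩
            sum (λ (r : Z) → 1)                           ≡⟨ ∑-const-1 n ⟩
            n                                             ≡⟨ m+n∸n≡m n 2 ⟨
            n + 2 ∸ 2                                     ≡⟨ cong (_∸ 2) (trans (∣toSub∣ ⌊ Big? i ⌋) (big-size i)) ⟨
            ∣ toSub ⌊ Big? i ⌋ ∣ ∸ 2                       ∎ }
        where
          open ≡-Reasoning
          big∈ : ∀ {r} → ⌊ Big? i ⌋ ∈ design r
          big∈ = ∈-++⁺ˡ (Any.tabulate⁺ {f = λ i → ⌊ Big? i ⌋} i refl)
          big-through : Contains₃ x y z (toSub ⌊ Big? i ⌋) ≡ true
          big-through = trans (contains₃-toSub x y z ⌊ Big? i ⌋) (dec-true (Big? i p ×-dec (Big? i q ×-dec Big? i s)) inBig)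
          unique : ∀ {B} → B ∈ concat Ds → Contains₃ x y z B ≡ true → B ≡ toSub ⌊ Big? i ⌋
          unique B∈ contains with ∈-Ds⁻ B∈
          ... | r , χ , χ∈ , refl =
            count≡1⇒unique (Contains₃ x y z)
                           (trans (count-toSub (Contains₃ x y z) (Through₃ p q s) (contains₃-toSub x y z) r) (once r))
                           (∈-map⁺ toSub χ∈) contains (∈-map⁺ toSub big∈) big-through

      small-triple-cover : (∀ i → ¬ InBig i p q s) → sum (λ r → count (Through₃ p q s) (design r)) ≡ 1 →
                           TripleCover (concat Ds) x y z
      small-triple-cover ¬big once
        with 1≤count⇒∈ (Contains₃ x y z) (concat Ds) (subst (1 ≤_) (sym (trans (count-Ds x y z) once)) (s≤s z≤n))
      ... | B , B∈ , contains = record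
        { block   = B
        ; ∈L      = B∈
        ; through = contains
        ; unique  = λ B′∈ contains′ → count≡1⇒unique (Contains₃ x y z) total B′∈ contains′ B∈ contains
        ; count≡  = trans total (sym size-3) }
        where
          total : count (Contains₃ x y z) (concat Ds) ≡ 1
          total = trans (count-Ds x y z) once
          size-3 : ∣ B ∣ ∸ 2 ≡ 1
          size-3 with ∈-Ds⁻ B∈
          ... | r , χ , χ∈ , refl with shape χ∈
          ... | big i refl = ⊥-elim (¬big i (witness (Big? i p ×-dec (Big? i q ×-dec Big? i s))
                                                    (Equivalence.from T-≡ (trans (sym (contains₃-toSub x y z ⌊ Big? i ⌋)) contains))))
          ... | triangle t = cong (_∸ 2) (trans (∣toSub∣ χ) (Triangle.size≡3 t))

    triple-cover : ∀ {x y z} → x ≢ y → x ≢ z → y ≢ z → TripleCover (concat Ds) x y z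
    triple-cover x≢y x≢z y≢z with cover (x≢y ∘ fromFin-injective) (x≢z ∘ fromFin-injective) (y≢z ∘ fromFin-injective)
    ... | in-big i inBig once = big-triple-cover i inBig once
    ... | in-small ¬big once  = small-triple-cover ¬big once

    K₃ Kbig K : SizeSet
    K₃ m = m ≡ 3
    Kbig m = m ≡ n + 2
    K = K₃ ∪K (K₃ ∪K Kbig)

    private
      size-in-K : ∀ {χ} → Shape χ → K ∣ toSub χ ∣
      size-in-K (big i refl) = inj₂ (inj₂ (trans (∣toSub∣ ⌊ Big? i ⌋) (big-size i)))
      size-in-K {χ} (triangle t) = inj₁ (trans (∣toSub∣ χ) (Triangle.size≡3 t))

      size-selected : ∀ {χ} → Shape χ → selK K₃ K₃ Kbig (infCount i₁ i₂ (toSub χ)) ∣ toSub χ ∣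
      size-selected (big i refl) rewrite infCount-toSub ⌊ Big? i ⌋ = trans (∣toSub∣ ⌊ Big? i ⌋) (big-size i)
      size-selected {χ} (triangle t) rewrite infCount-toSub χ with Triangle.infinities≤1 t
      ... | inj₁ none rewrite none = trans (∣toSub∣ χ) (Triangle.size≡3 t)
      ... | inj₂ one  rewrite one  = trans (∣toSub∣ χ) (Triangle.size≡3 t)

      toFin-injective : ∀ {p q} → toFin p ≡ toFin q → p ≡ q
      toFin-injective {p} {q} e = trans (sym (fromFin-toFin p)) (trans (cong fromFin e) (fromFin-toFin q))

      corners-on-Fin : ∀ {χ} → (∃[ p ] ∃[ q ] ∃[ s ] Distinct₃ p q s × Through₃ p q s χ ≡ true) →
                       ∃[ x ] ∃[ y ] ∃[ z ] x ≢ y × x ≢ z × y ≢ z × Contains₃ x y z (toSub χ) ≡ true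
      corners-on-Fin {χ} (p , q , s , (p≢q , p≢s , q≢s) , through) =
        toFin p , toFin q , toFin s , p≢q ∘ toFin-injective , p≢s ∘ toFin-injective , q≢s ∘ toFin-injective ,
        trans (cong₂ _∧_ (lookup-toSub χ p) (cong₂ _∧_ (lookup-toSub χ q) (lookup-toSub χ s))) through

      corners-of : ∀ {χ} → Shape χ → ∃[ x ] ∃[ y ] ∃[ z ] x ≢ y × x ≢ z × y ≢ z × Contains₃ x y z (toSub χ) ≡ true
      corners-of (big i refl) = corners-on-Fin {⌊ Big? i ⌋} (big-corners i)
      corners-of {χ} (triangle t) = corners-on-Fin {χ} (Triangle.corners t)

    i₁≢i₂ : i₁ ≢ i₂
    i₁≢i₂ e with trans (sym (fromFin-toFin (∞ 0F))) (trans (cong fromFin e) (fromFin-toFin (∞ 1F)))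
    ... | ()

    designs-S2 : All (IsS2 3 K v) Ds
    designs-S2 = tabulate⁺ λ r → map⁺ (All.tabulate (size-in-K ∘ shape)) , λ x y x≢y →
      trans (count-toSub (λ B → lookup B x ∧ lookup B y) (Through₂ (fromFin x) (fromFin y))
                         (λ χ → cong₂ _∧_ (lookup∘tabulate (χ ∘ fromFin) x) (lookup∘tabulate (χ ∘ fromFin) y)) r)
            (pair-count r (x≢y ∘ fromFin-injective))

    is-LS₃ : IsLS₃ 3 K₃ K₃ Kbig v i₁ i₂ Ds
    is-LS₃ = i₁≢i₂ ,
             (designs-S2 , covered-S3 {K = K} sizes corners triple-cover ,
              covered-multiplicity {K = K} sizes corners triple-cover) ,
             tabulate⁺ (λ r → map⁺ (All.tabulate (size-selected ∘ shape)))
      where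
        sizes : ∀ {B} → B ∈ concat Ds → K ∣ B ∣
        sizes B∈ with ∈-Ds⁻ B∈
        ... | r , χ , χ∈ , refl = size-in-K (shape χ∈)
        corners : ∀ {B} → B ∈ concat Ds → ∃[ x ] ∃[ y ] ∃[ z ] x ≢ y × x ≢ z × y ≢ z × Contains₃ x y z B ≡ true
        corners B∈ with ∈-Ds⁻ B∈
        ... | r , χ , χ∈ , refl = corners-of (shape χ∈)

module ModularArithmetic where

  open import Data.Nat using (ℕ; zero; suc; _+_; _*_; _∸_; _%_; NonZero)
  open import Data.Nat.Properties using (+-comm; +-assoc; m+[n∸m]≡n; <⇒≤; *-distribʳ-+)
  open import Data.Nat.DivMod using (_mod_; m%n<n; %-distribˡ-+; %-distribˡ-*; m%n%n≡m%n; m<n⇒m%n≡m; n%n≡0; [m+kn]%n≡m%n)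
  open import Data.Nat.Solver using (module +-*-Solver)
  open import Data.Fin using (Fin; toℕ; zero)
  open import Data.Fin.Properties using (toℕ-injective; toℕ-fromℕ<; toℕ<n)
  open import Data.Product using (_,_)
  open import Algebra.Structures using (IsAbelianGroup)
  open import Relation.Binary.PropositionalEquality
  open ≡-Reasoning

  module _ (n : ℕ) .{{_ : NonZero n}} where

    toℕ-mod : ∀ x → toℕ (x mod n) ≡ x % n
    toℕ-mod x = toℕ-fromℕ< (m%n<n x n)

    %-absorbˡ : ∀ x y → (x % n + y) % n ≡ (x + y) % n
    %-absorbˡ x y = begin
      (x % n + y) % n           ≡⟨ %-distribˡ-+ (x % n) y n ⟩
      (x % n % n + y % n) % n   ≡⟨ cong (λ t → (t + y % n) % n) (m%n%n≡m%n x n) ⟩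
      (x % n + y % n) % n       ≡⟨ %-distribˡ-+ x y n ⟨
      (x + y) % n               ∎

    %-absorbʳ : ∀ x y → (x + y % n) % n ≡ (x + y) % n
    %-absorbʳ x y = begin
      (x + y % n) % n   ≡⟨ cong (_% n) (+-comm x (y % n)) ⟩
      (y % n + x) % n   ≡⟨ %-absorbˡ y x ⟩
      (y + x) % n       ≡⟨ cong (_% n) (+-comm y x) ⟩
      (x + y) % n       ∎

    %-absorb-*ˡ : ∀ x y → (x % n * y) % n ≡ (x * y) % n
    %-absorb-*ˡ x y = begin
      (x % n * y) % n           ≡⟨ %-distribˡ-* (x % n) y n ⟩
      (x % n % n * (y % n)) % n ≡⟨ cong (λ t → (t * (y % n)) % n) (m%n%n≡m%n x n) ⟩
      (x % n * (y % n)) % n     ≡⟨ %-distribˡ-* x y n ⟨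
      (x * y) % n               ∎

  module ℤ/suc (m : ℕ) where

    private
      n : ℕ
      n = suc m

    infixl 6 _⊕_

    _⊕_ : Fin n → Fin n → Fin n
    a ⊕ b = (toℕ a + toℕ b) mod n

    ⊖_ : Fin n → Fin n
    ⊖ a = (n ∸ toℕ a) mod n

    toℕ-⊕ : ∀ a b → toℕ (a ⊕ b) ≡ (toℕ a + toℕ b) % n
    toℕ-⊕ a b = toℕ-mod n (toℕ a + toℕ b)

    private
      ⊕-assoc : ∀ a b c → (a ⊕ b) ⊕ c ≡ a ⊕ (b ⊕ c)
      ⊕-assoc a b c = toℕ-injective (begin
        toℕ ((a ⊕ b) ⊕ c)                    ≡⟨ toℕ-⊕ (a ⊕ b) c ⟩
        (toℕ (a ⊕ b) + toℕ c) % n            ≡⟨ cong (λ t → (t + toℕ c) % n) (toℕ-⊕ a b) ⟩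
        ((toℕ a + toℕ b) % n + toℕ c) % n    ≡⟨ %-absorbˡ n (toℕ a + toℕ b) (toℕ c) ⟩
        (toℕ a + toℕ b + toℕ c) % n          ≡⟨ cong (_% n) (+-assoc (toℕ a) _ _) ⟩
        (toℕ a + (toℕ b + toℕ c)) % n        ≡⟨ %-absorbʳ n (toℕ a) (toℕ b + toℕ c) ⟨
        (toℕ a + (toℕ b + toℕ c) % n) % n    ≡⟨ cong (λ t → (toℕ a + t) % n) (toℕ-⊕ b c) ⟨
        (toℕ a + toℕ (b ⊕ c)) % n            ≡⟨ toℕ-⊕ a (b ⊕ c) ⟨
        toℕ (a ⊕ (b ⊕ c))                    ∎)

      ⊕-comm : ∀ a b → a ⊕ b ≡ b ⊕ a
      ⊕-comm a b = cong (_mod n) (+-comm (toℕ a) (toℕ b))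

      ⊕-identityˡ : ∀ a → zero ⊕ a ≡ a
      ⊕-identityˡ a = toℕ-injective (trans (toℕ-⊕ zero a) (m<n⇒m%n≡m (toℕ<n a)))

      ⊖-inverseˡ : ∀ a → ⊖ a ⊕ a ≡ zero
      ⊖-inverseˡ a = toℕ-injective (begin
        toℕ (⊖ a ⊕ a)                   ≡⟨ toℕ-⊕ (⊖ a) a ⟩
        (toℕ (⊖ a) + toℕ a) % n         ≡⟨ cong (λ t → (t + toℕ a) % n) (toℕ-mod n (n ∸ toℕ a)) ⟩
        ((n ∸ toℕ a) % n + toℕ a) % n   ≡⟨ %-absorbˡ n (n ∸ toℕ a) (toℕ a) ⟩
        (n ∸ toℕ a + toℕ a) % n         ≡⟨ cong (_% n) (+-comm (n ∸ toℕ a) (toℕ a)) ⟩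
        (toℕ a + (n ∸ toℕ a)) % n       ≡⟨ cong (_% n) (m+[n∸m]≡n (<⇒≤ (toℕ<n a))) ⟩
        n % n                           ≡⟨ n%n≡0 n ⟩
        0                               ∎)

    isAbelianGroup : IsAbelianGroup _≡_ _⊕_ zero ⊖_
    isAbelianGroup = record
      { isGroup = record
        { isMonoid = record
          { isSemigroup = record { isMagma = record { isEquivalence = isEquivalence ; ∙-cong = cong₂ _⊕_ }
                                 ; assoc = ⊕-assoc }
          ; identity = ⊕-identityˡ , λ a → trans (⊕-comm a zero) (⊕-identityˡ a) }
        ; inverse = ⊖-inverseˡ , λ a → trans (⊕-comm a (⊖ a)) (⊖-inverseˡ a)
        ; ⁻¹-cong = cong ⊖_ }
      ; comm = ⊕-comm }

  -- in ℤ/(2k+1) halving is multiplication by k + 1, the inverse of 2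
  module Halving (k : ℕ) where

    private
      n : ℕ
      n = suc (2 * k)

    open ℤ/suc (2 * k) using (_⊕_; toℕ-⊕)

    half : Fin n → Fin n
    half a = (toℕ a * suc k) mod n

    private
      doubled-factor : ∀ t → (t * suc k + t * suc k) % n ≡ t % n
      doubled-factor t = trans (cong (_% n) (identity t k)) ([m+kn]%n≡m%n t t n)
        where
          open +-*-Solver
          identity : ∀ t k → t * suc k + t * suc k ≡ t + t * suc (2 * k)
          identity = solve 2 (λ t k → t :* (con 1 :+ k) :+ t :* (con 1 :+ k)
                                    := t :+ t :* (con 1 :+ con 2 :* k)) refl

    half-double : ∀ a → half (a ⊕ a) ≡ a
    half-double a = toℕ-injective (begin
      toℕ (half (a ⊕ a))                       ≡⟨ toℕ-mod n (toℕ (a ⊕ a) * suc k) ⟩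
      (toℕ (a ⊕ a) * suc k) % n                ≡⟨ cong (λ t → (t * suc k) % n) (toℕ-⊕ a a) ⟩
      ((toℕ a + toℕ a) % n * suc k) % n        ≡⟨ %-absorb-*ˡ n (toℕ a + toℕ a) (suc k) ⟩
      ((toℕ a + toℕ a) * suc k) % n            ≡⟨ cong (_% n) (*-distribʳ-+ (suc k) (toℕ a) (toℕ a)) ⟩
      (toℕ a * suc k + toℕ a * suc k) % n      ≡⟨ doubled-factor (toℕ a) ⟩
      toℕ a % n                                ≡⟨ m<n⇒m%n≡m (toℕ<n a) ⟩
      toℕ a                                    ∎)

    double-half : ∀ a → half a ⊕ half a ≡ a
    double-half a = toℕ-injective (begin
      toℕ (half a ⊕ half a)                    ≡⟨ toℕ-⊕ (half a) (half a) ⟩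
      (toℕ (half a) + toℕ (half a)) % n        ≡⟨ cong (λ t → (t + t) % n) (toℕ-mod n h) ⟩
      (h % n + h % n) % n                      ≡⟨ %-distribˡ-+ h h n ⟨
      (h + h) % n                              ≡⟨ doubled-factor (toℕ a) ⟩
      toℕ a % n                                ≡⟨ m<n⇒m%n≡m (toℕ<n a) ⟩
      toℕ a                                    ∎)
      where
        h : ℕ
        h = toℕ a * suc k

module Examples where

  open import Defs
  open Verification
  open import Data.Nat using (ℕ; _+_; _%_; _<ᵇ_; NonZero)
  open import Data.Bool using (if_then_else_)
  open import Data.Fin using (toℕ)
  open import Data.List using (List; []; _∷_; map; upTo)
  open import Data.Nat.Properties using (_≟_)
  open import Data.List.Membership.DecPropositional _≟_ using (_∈?_)
  open import Data.Vec using (tabulate)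
  open import Data.Product using (∃-syntax; _,_)
  open import Data.Unit using (tt)
  open import Relation.Nullary using (does)
  open import Function using (_∘_)

  point-set : ∀ v → List ℕ → Block v
  point-set v xs = tabulate λ i → does (toℕ i ∈? xs)

  rotate : (N : ℕ) .{{_ : NonZero N}} → ℕ → ℕ → ℕ
  rotate N r x = if x <ᵇ N then (x + r) % N else x

  develop : ∀ v (N : ℕ) .{{_ : NonZero N}} → ℕ → List (List ℕ) → List (List (Block v))
  develop v N H base = map (λ r → map (point-set v ∘ map (rotate N r)) base) (upTo H)

  base14 : List (List ℕ)
  base14 =
    (0 ∷ 4 ∷ 8 ∷ 12 ∷ 13 ∷ []) ∷ (2 ∷ 6 ∷ 10 ∷ 12 ∷ 13 ∷ []) ∷ (4 ∷ 5 ∷ 6 ∷ []) ∷ (0 ∷ 10 ∷ 11 ∷ []) ∷ (4 ∷ 5 ∷ 7 ∷ []) ∷ (1 ∷ 10 ∷ 11 ∷ []) ∷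
    (2 ∷ 3 ∷ 6 ∷ []) ∷ (0 ∷ 8 ∷ 9 ∷ []) ∷ (2 ∷ 3 ∷ 7 ∷ []) ∷ (1 ∷ 8 ∷ 9 ∷ []) ∷ (0 ∷ 1 ∷ 6 ∷ []) ∷ (0 ∷ 6 ∷ 7 ∷ []) ∷
    (1 ∷ 2 ∷ 8 ∷ []) ∷ (2 ∷ 7 ∷ 8 ∷ []) ∷ (1 ∷ 5 ∷ 6 ∷ []) ∷ (0 ∷ 7 ∷ 11 ∷ []) ∷ (0 ∷ 3 ∷ 4 ∷ []) ∷ (6 ∷ 9 ∷ 10 ∷ []) ∷
    (1 ∷ 3 ∷ 4 ∷ []) ∷ (7 ∷ 9 ∷ 10 ∷ []) ∷ (1 ∷ 2 ∷ 12 ∷ []) ∷ (7 ∷ 8 ∷ 12 ∷ []) ∷ (0 ∷ 1 ∷ 13 ∷ []) ∷ (6 ∷ 7 ∷ 13 ∷ []) ∷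
    (4 ∷ 6 ∷ 8 ∷ []) ∷ (0 ∷ 2 ∷ 10 ∷ []) ∷ (0 ∷ 2 ∷ 5 ∷ []) ∷ (6 ∷ 8 ∷ 11 ∷ []) ∷ (5 ∷ 7 ∷ 11 ∷ []) ∷ (1 ∷ 5 ∷ 11 ∷ []) ∷
    (2 ∷ 4 ∷ 9 ∷ []) ∷ (3 ∷ 8 ∷ 10 ∷ []) ∷ (1 ∷ 3 ∷ 9 ∷ []) ∷ (3 ∷ 7 ∷ 9 ∷ []) ∷ (2 ∷ 4 ∷ 11 ∷ []) ∷ (5 ∷ 8 ∷ 10 ∷ []) ∷
    (3 ∷ 5 ∷ 12 ∷ []) ∷ (9 ∷ 11 ∷ 12 ∷ []) ∷ (3 ∷ 5 ∷ 13 ∷ []) ∷ (9 ∷ 11 ∷ 13 ∷ []) ∷ (4 ∷ 7 ∷ 10 ∷ []) ∷ (1 ∷ 4 ∷ 10 ∷ []) ∷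
    (2 ∷ 5 ∷ 9 ∷ []) ∷ (3 ∷ 8 ∷ 11 ∷ []) ∷ (3 ∷ 6 ∷ 11 ∷ []) ∷ (0 ∷ 5 ∷ 9 ∷ []) ∷ (0 ∷ 3 ∷ 12 ∷ []) ∷ (6 ∷ 9 ∷ 12 ∷ []) ∷
    (5 ∷ 8 ∷ 13 ∷ []) ∷ (2 ∷ 11 ∷ 13 ∷ []) ∷ (5 ∷ 10 ∷ 12 ∷ []) ∷ (4 ∷ 11 ∷ 12 ∷ []) ∷ (4 ∷ 9 ∷ 13 ∷ []) ∷ (3 ∷ 10 ∷ 13 ∷ []) ∷
    (1 ∷ 7 ∷ 12 ∷ []) ∷ (1 ∷ 7 ∷ 13 ∷ []) ∷ []

  base26 : List (List ℕ)
  base26 =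
    (0 ∷ 8 ∷ 16 ∷ 24 ∷ 25 ∷ []) ∷ (4 ∷ 12 ∷ 20 ∷ 24 ∷ 25 ∷ []) ∷ (7 ∷ 8 ∷ 9 ∷ []) ∷ (19 ∷ 20 ∷ 21 ∷ []) ∷ (8 ∷ 9 ∷ 11 ∷ []) ∷ (20 ∷ 21 ∷ 23 ∷ []) ∷
    (1 ∷ 2 ∷ 5 ∷ []) ∷ (13 ∷ 14 ∷ 17 ∷ []) ∷ (2 ∷ 3 ∷ 7 ∷ []) ∷ (14 ∷ 15 ∷ 19 ∷ []) ∷ (2 ∷ 3 ∷ 8 ∷ []) ∷ (14 ∷ 15 ∷ 20 ∷ []) ∷
    (0 ∷ 1 ∷ 7 ∷ []) ∷ (12 ∷ 13 ∷ 19 ∷ []) ∷ (6 ∷ 7 ∷ 14 ∷ []) ∷ (2 ∷ 18 ∷ 19 ∷ []) ∷ (3 ∷ 4 ∷ 12 ∷ []) ∷ (0 ∷ 15 ∷ 16 ∷ []) ∷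
    (0 ∷ 1 ∷ 10 ∷ []) ∷ (12 ∷ 13 ∷ 22 ∷ []) ∷ (4 ∷ 5 ∷ 15 ∷ []) ∷ (3 ∷ 16 ∷ 17 ∷ []) ∷ (4 ∷ 5 ∷ 16 ∷ []) ∷ (4 ∷ 16 ∷ 17 ∷ []) ∷
    (1 ∷ 2 ∷ 14 ∷ []) ∷ (2 ∷ 13 ∷ 14 ∷ []) ∷ (3 ∷ 4 ∷ 17 ∷ []) ∷ (5 ∷ 15 ∷ 16 ∷ []) ∷ (2 ∷ 11 ∷ 12 ∷ []) ∷ (0 ∷ 14 ∷ 23 ∷ []) ∷
    (6 ∷ 7 ∷ 22 ∷ []) ∷ (10 ∷ 18 ∷ 19 ∷ []) ∷ (0 ∷ 7 ∷ 8 ∷ []) ∷ (12 ∷ 19 ∷ 20 ∷ []) ∷ (3 ∷ 9 ∷ 10 ∷ []) ∷ (15 ∷ 21 ∷ 22 ∷ []) ∷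
    (6 ∷ 11 ∷ 12 ∷ []) ∷ (0 ∷ 18 ∷ 23 ∷ []) ∷ (5 ∷ 9 ∷ 10 ∷ []) ∷ (17 ∷ 21 ∷ 22 ∷ []) ∷ (7 ∷ 10 ∷ 11 ∷ []) ∷ (19 ∷ 22 ∷ 23 ∷ []) ∷
    (3 ∷ 5 ∷ 6 ∷ []) ∷ (15 ∷ 17 ∷ 18 ∷ []) ∷ (10 ∷ 11 ∷ 24 ∷ []) ∷ (22 ∷ 23 ∷ 24 ∷ []) ∷ (5 ∷ 6 ∷ 25 ∷ []) ∷ (17 ∷ 18 ∷ 25 ∷ []) ∷
    (10 ∷ 12 ∷ 14 ∷ []) ∷ (0 ∷ 2 ∷ 22 ∷ []) ∷ (0 ∷ 2 ∷ 5 ∷ []) ∷ (12 ∷ 14 ∷ 17 ∷ []) ∷ (6 ∷ 8 ∷ 12 ∷ []) ∷ (0 ∷ 18 ∷ 20 ∷ []) ∷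
    (8 ∷ 10 ∷ 15 ∷ []) ∷ (3 ∷ 20 ∷ 22 ∷ []) ∷ (2 ∷ 4 ∷ 10 ∷ []) ∷ (14 ∷ 16 ∷ 22 ∷ []) ∷ (4 ∷ 6 ∷ 13 ∷ []) ∷ (1 ∷ 16 ∷ 18 ∷ []) ∷
    (3 ∷ 5 ∷ 13 ∷ []) ∷ (1 ∷ 15 ∷ 17 ∷ []) ∷ (11 ∷ 13 ∷ 22 ∷ []) ∷ (1 ∷ 10 ∷ 23 ∷ []) ∷ (9 ∷ 11 ∷ 21 ∷ []) ∷ (9 ∷ 21 ∷ 23 ∷ []) ∷
    (8 ∷ 10 ∷ 21 ∷ []) ∷ (9 ∷ 20 ∷ 22 ∷ []) ∷ (1 ∷ 3 ∷ 15 ∷ []) ∷ (3 ∷ 13 ∷ 15 ∷ []) ∷ (5 ∷ 7 ∷ 20 ∷ []) ∷ (8 ∷ 17 ∷ 19 ∷ []) ∷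
    (5 ∷ 7 ∷ 21 ∷ []) ∷ (9 ∷ 17 ∷ 19 ∷ []) ∷ (4 ∷ 6 ∷ 21 ∷ []) ∷ (9 ∷ 16 ∷ 18 ∷ []) ∷ (5 ∷ 11 ∷ 13 ∷ []) ∷ (1 ∷ 17 ∷ 23 ∷ []) ∷
    (5 ∷ 10 ∷ 12 ∷ []) ∷ (0 ∷ 17 ∷ 22 ∷ []) ∷ (3 ∷ 7 ∷ 9 ∷ []) ∷ (15 ∷ 19 ∷ 21 ∷ []) ∷ (2 ∷ 4 ∷ 23 ∷ []) ∷ (11 ∷ 14 ∷ 16 ∷ []) ∷
    (6 ∷ 8 ∷ 24 ∷ []) ∷ (18 ∷ 20 ∷ 24 ∷ []) ∷ (1 ∷ 3 ∷ 25 ∷ []) ∷ (13 ∷ 15 ∷ 25 ∷ []) ∷ (0 ∷ 3 ∷ 6 ∷ []) ∷ (12 ∷ 15 ∷ 18 ∷ []) ∷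
    (1 ∷ 4 ∷ 8 ∷ []) ∷ (13 ∷ 16 ∷ 20 ∷ []) ∷ (1 ∷ 4 ∷ 9 ∷ []) ∷ (13 ∷ 16 ∷ 21 ∷ []) ∷ (6 ∷ 9 ∷ 15 ∷ []) ∷ (3 ∷ 18 ∷ 21 ∷ []) ∷
    (8 ∷ 11 ∷ 18 ∷ []) ∷ (6 ∷ 20 ∷ 23 ∷ []) ∷ (4 ∷ 7 ∷ 15 ∷ []) ∷ (3 ∷ 16 ∷ 19 ∷ []) ∷ (11 ∷ 14 ∷ 23 ∷ []) ∷ (2 ∷ 11 ∷ 23 ∷ []) ∷
    (5 ∷ 8 ∷ 18 ∷ []) ∷ (6 ∷ 17 ∷ 20 ∷ []) ∷ (0 ∷ 10 ∷ 13 ∷ []) ∷ (1 ∷ 12 ∷ 22 ∷ []) ∷ (0 ∷ 9 ∷ 12 ∷ []) ∷ (0 ∷ 12 ∷ 21 ∷ []) ∷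
    (6 ∷ 9 ∷ 22 ∷ []) ∷ (10 ∷ 18 ∷ 21 ∷ []) ∷ (2 ∷ 9 ∷ 12 ∷ []) ∷ (0 ∷ 14 ∷ 21 ∷ []) ∷ (4 ∷ 10 ∷ 13 ∷ []) ∷ (1 ∷ 16 ∷ 22 ∷ []) ∷
    (4 ∷ 7 ∷ 23 ∷ []) ∷ (11 ∷ 16 ∷ 19 ∷ []) ∷ (1 ∷ 5 ∷ 8 ∷ []) ∷ (13 ∷ 17 ∷ 20 ∷ []) ∷ (0 ∷ 3 ∷ 24 ∷ []) ∷ (12 ∷ 15 ∷ 24 ∷ []) ∷
    (7 ∷ 10 ∷ 25 ∷ []) ∷ (19 ∷ 22 ∷ 25 ∷ []) ∷ (7 ∷ 11 ∷ 15 ∷ []) ∷ (3 ∷ 19 ∷ 23 ∷ []) ∷ (8 ∷ 12 ∷ 17 ∷ []) ∷ (0 ∷ 5 ∷ 20 ∷ []) ∷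
    (6 ∷ 10 ∷ 16 ∷ []) ∷ (4 ∷ 18 ∷ 22 ∷ []) ∷ (0 ∷ 4 ∷ 11 ∷ []) ∷ (12 ∷ 16 ∷ 23 ∷ []) ∷ (5 ∷ 9 ∷ 17 ∷ []) ∷ (5 ∷ 17 ∷ 21 ∷ []) ∷
    (6 ∷ 10 ∷ 19 ∷ []) ∷ (7 ∷ 18 ∷ 22 ∷ []) ∷ (2 ∷ 6 ∷ 16 ∷ []) ∷ (4 ∷ 14 ∷ 18 ∷ []) ∷ (2 ∷ 6 ∷ 17 ∷ []) ∷ (5 ∷ 14 ∷ 18 ∷ []) ∷
    (1 ∷ 9 ∷ 13 ∷ []) ∷ (1 ∷ 13 ∷ 21 ∷ []) ∷ (3 ∷ 10 ∷ 14 ∷ []) ∷ (2 ∷ 15 ∷ 22 ∷ []) ∷ (4 ∷ 8 ∷ 22 ∷ []) ∷ (10 ∷ 16 ∷ 20 ∷ []) ∷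
    (0 ∷ 4 ∷ 19 ∷ []) ∷ (7 ∷ 12 ∷ 16 ∷ []) ∷ (9 ∷ 13 ∷ 24 ∷ []) ∷ (1 ∷ 21 ∷ 24 ∷ []) ∷ (11 ∷ 15 ∷ 25 ∷ []) ∷ (3 ∷ 23 ∷ 25 ∷ []) ∷
    (10 ∷ 15 ∷ 20 ∷ []) ∷ (3 ∷ 8 ∷ 22 ∷ []) ∷ (8 ∷ 13 ∷ 19 ∷ []) ∷ (1 ∷ 7 ∷ 20 ∷ []) ∷ (6 ∷ 11 ∷ 18 ∷ []) ∷ (6 ∷ 18 ∷ 23 ∷ []) ∷
    (1 ∷ 6 ∷ 14 ∷ []) ∷ (2 ∷ 13 ∷ 18 ∷ []) ∷ (7 ∷ 12 ∷ 21 ∷ []) ∷ (0 ∷ 9 ∷ 19 ∷ []) ∷ (8 ∷ 13 ∷ 23 ∷ []) ∷ (1 ∷ 11 ∷ 20 ∷ []) ∷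
    (4 ∷ 9 ∷ 20 ∷ []) ∷ (8 ∷ 16 ∷ 21 ∷ []) ∷ (2 ∷ 7 ∷ 19 ∷ []) ∷ (7 ∷ 14 ∷ 19 ∷ []) ∷ (1 ∷ 6 ∷ 19 ∷ []) ∷ (7 ∷ 13 ∷ 18 ∷ []) ∷
    (9 ∷ 14 ∷ 24 ∷ []) ∷ (2 ∷ 21 ∷ 24 ∷ []) ∷ (9 ∷ 14 ∷ 25 ∷ []) ∷ (2 ∷ 21 ∷ 25 ∷ []) ∷ (8 ∷ 14 ∷ 20 ∷ []) ∷ (2 ∷ 8 ∷ 20 ∷ []) ∷
    (0 ∷ 11 ∷ 17 ∷ []) ∷ (5 ∷ 12 ∷ 23 ∷ []) ∷ (9 ∷ 15 ∷ 23 ∷ []) ∷ (3 ∷ 11 ∷ 21 ∷ []) ∷ (0 ∷ 6 ∷ 15 ∷ []) ∷ (3 ∷ 12 ∷ 18 ∷ []) ∷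
    (7 ∷ 13 ∷ 23 ∷ []) ∷ (1 ∷ 11 ∷ 19 ∷ []) ∷ (5 ∷ 11 ∷ 22 ∷ []) ∷ (10 ∷ 17 ∷ 23 ∷ []) ∷ (11 ∷ 17 ∷ 24 ∷ []) ∷ (5 ∷ 23 ∷ 24 ∷ []) ∷
    (8 ∷ 14 ∷ 25 ∷ []) ∷ (2 ∷ 20 ∷ 25 ∷ []) ∷ (2 ∷ 9 ∷ 16 ∷ []) ∷ (4 ∷ 14 ∷ 21 ∷ []) ∷ (8 ∷ 15 ∷ 23 ∷ []) ∷ (3 ∷ 11 ∷ 20 ∷ []) ∷
    (2 ∷ 10 ∷ 17 ∷ []) ∷ (5 ∷ 14 ∷ 22 ∷ []) ∷ (6 ∷ 13 ∷ 24 ∷ []) ∷ (1 ∷ 18 ∷ 24 ∷ []) ∷ (4 ∷ 11 ∷ 25 ∷ []) ∷ (16 ∷ 23 ∷ 25 ∷ []) ∷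
    (7 ∷ 16 ∷ 24 ∷ []) ∷ (4 ∷ 19 ∷ 24 ∷ []) ∷ (9 ∷ 18 ∷ 25 ∷ []) ∷ (6 ∷ 21 ∷ 25 ∷ []) ∷ (7 ∷ 17 ∷ 24 ∷ []) ∷ (5 ∷ 19 ∷ 24 ∷ []) ∷
    (7 ∷ 17 ∷ 25 ∷ []) ∷ (5 ∷ 19 ∷ 25 ∷ []) ∷ (3 ∷ 14 ∷ 24 ∷ []) ∷ (2 ∷ 15 ∷ 24 ∷ []) ∷ (1 ∷ 12 ∷ 25 ∷ []) ∷ (0 ∷ 13 ∷ 25 ∷ []) ∷
    (10 ∷ 22 ∷ 24 ∷ []) ∷ (10 ∷ 22 ∷ 25 ∷ []) ∷ []

  ls14 : ∃[ Ds ] IsLS 2 K35 14 Ds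
  ls14 = develop 14 12 6 base14 , check-LS-sound (develop 14 12 6 base14) tt

  ls26 : ∃[ Ds ] IsLS 2 K35 26 Ds
  ls26 = develop 26 24 12 base26 , check-LS-sound (develop 26 24 12 base26) tt

module Instances where

  open import Defs
  open ModularArithmetic
  open Construction
  open Relabel
  open import Data.Nat using (ℕ; suc; _+_; _*_)
  open import Data.Fin using (zero)
  open import Data.Product using (∃-syntax; _,_)
  open import Relation.Binary.PropositionalEquality

  ℤ/odd : ∀ k → HalvingGroup (suc (2 * k))
  ℤ/odd k = record
    { _⊕_ = _⊕_ ; 0# = zero ; -_ = ⊖_ ; isAbelianGroup = isAbelianGroup
    ; half = half ; half-double = half-double ; double-half = double-half }
    where
      open ℤ/suc (2 * k)
      open Halving k

  part2 : (w : ℕ) → Odd w → ∃[ i₁ ] ∃[ i₂ ] ∃[ Ds ]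
            IsLS₃ 3 (λ n → n ≡ 3) (λ n → n ≡ 3) (λ n → n ≡ w + 2) (3 * w + 2) i₁ i₂ Ds
  part2 .(suc (2 * k)) (k , refl) = i₁ G , i₂ G , Ds G , is-LS₃ G
    where G = ℤ/odd k

lemma2p10 : ((∃[ Ds ] IsLS 2 K35 14 Ds) × (∃[ Ds ] IsLS 2 K35 26 Ds)) ×
            ((w : ℕ) → Odd w →
               ∃[ i₁ ] ∃[ i₂ ] ∃[ Ds ]
                 IsLS₃ 3 (λ n → n ≡ 3) (λ n → n ≡ 3) (λ n → n ≡ w + 2) (3 * w + 2) i₁ i₂ Ds)
lemma2p10 = (Examples.ls14 , Examples.ls26) , Instances.part2
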